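{- Let $n\ge 1$ and let $\Sigma$ be an $[\underline{\ell_\infty},\ell_1,\dots,\ell_t]$-starter over $\mathbb{Z}_{2n}$. Then (1) there is a $2$-pyramidal solution to $OP^-([\ell_\infty+1,\ell_1,\dots,\ell_t])$, i.e. a $2$-pyramidal factorization of $K_{2n+2}-I$, for some $1$-factor $I$ of $K_{2n+2}$, into copies of the $2$-regular graph with cycles of lengths $\ell_\infty+1,\ell_1,\dots,\ell_t$; (2) there is a regular solution to $OP^+([\ell_\infty-1,\ell_1,\dots,\ell_t])$, i.e. a regular factorization of $K_{2n}+J$, for some $1$-factor $J$ of $K_{2n}$, into copies of the $2$-regular graph with cycles of lengths $\ell_\infty-1,\ell_1,\dots,\ell_t$.
   Context: For a graph $\Gamma$ with vertices in $\mathbb{Z}_{2n}\cup\{\infty\}$, $\Delta\Gamma$ is the multiset of all differences $x-y$ (computed in $\mathbb{Z}_{2n}$) over ordered pairs $(x,y)$ of adjacent vertices with $x\ne\infty\ne y$, and $\Gamma+a$ is the graph obtained by replacing each vertex $x\ne\infty$ by $x+a$ (fixing $\infty$). A $2$-starter over $\mathbb{Z}_{2n}$ is a $2$-regular graph $\Sigma$ with vertex set $\mathbb{Z}_{2n}\cup\{\infty\}$ such that $\Delta\Sigma\supseteq\mathbb{Z}_{2n}\setminus\{0\}$ and $\Sigma+n=\Sigma$. It is an $[\underline{\ell_\infty},\ell_1,\dots,\ell_t]$-starter if its cycles have lengths $\ell_\infty,\ell_1,\dots,\ell_t$, where $\ell_\infty$ is the length of the cycle through $\infty$. $K_v+J$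 is the multigraph obtained from $K_v$ by doubling the edges of the $1$-factor $J$. An $F$-factorization of a multigraph is a collection of spanning subgraphs isomorphic to $F$ whose edge multisets partition the edge multiset. A factorization is $f$-pyramidal if it admits an automorphism group (vertex permutations mapping factors onto factors) fixing exactly $f$ vertices and acting sharply transitively on the remaining vertices; regular means $0$-pyramidal. -}

module Defs where

open import Data.Nat using (ℕ; zero; suc; _+_; _*_; _∸_; _≤_; NonZero)
open import Data.Nat.ListAction using (sum)
open import Data.Nat.Properties using (m*n≢0)
open import Data.Nat.DivMod using (_mod_)
open import Data.Fin using (Fin; toℕ) renaming (_≟_ to _≟ᶠ_)
open import Data.Fin.Permutation using (Permutation′; _⟨$⟩ʳ_)
open import Data.List using (List; []; _∷_; _++_; [_]; zip; map; length; concat; filter; allFin)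
open import Data.List.Relation.Unary.All using (All)
open import Data.List.Relation.Unary.Unique.Propositional using (Unique)
open import Data.List.Membership.Propositional using (_∈_)
open import Data.List.Relation.Binary.Permutation.Propositional using (_↭_)
open import Data.Maybe using (Maybe; just; nothing)
open import Data.Maybe.Properties using (≡-dec)
open import Data.Product using (Σ; ∃; ∃-syntax; _×_; _,_)
open import Data.Sum using (_⊎_)
open import Relation.Nullary using (¬_; _×-dec_; _⊎-dec_)
open import Relation.Binary using (DecidableEquality)
open import Relation.Binary.PropositionalEquality using (_≡_; _≢_)

-- 2-regular (multi)graphs given as vertex-disjoint unions of cycles.  A cycle of length 2
-- (a digon) contributes the edge {v₀,v₁} twice.

cycleEdges : {V : Set} → List V → List (V × V)
cycleEdges []       = []
cycleEdges (x ∷ xs) = zip (x ∷ xs) (xs ++ [ x ])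

module _ {V : Set} (_≟_ : DecidableEquality V) where

  cycleMult : List V → V → V → ℕ
  cycleMult c x y =
    length (filter (λ { (a , b) → ((a ≟ x) ×-dec (b ≟ y)) ⊎-dec ((a ≟ y) ×-dec (b ≟ x)) })
                   (cycleEdges c))

  mult : List (List V) → V → V → ℕ
  mult cs x y = sum (map (λ c → cycleMult c x y) cs)

IsTwoFactor : {V : Set} → ℕ → List V → List (List V) → Set
IsTwoFactor minLen verts cs = (concat cs ↭ verts) × All (λ c → minLen ≤ length c) cs

-- a 2-regular graph on Fin m with cycles of lengths L (as a multiset),
-- i.e. a copy of "the" 2-regular graph with cycle lengths L.
-- Digons (length-2 cycles, i.e. double edges) are allowed.
IsFactorOfType : (m : ℕ) → List ℕ → List (List (Fin m)) → Set
IsFactorOfType m L cs = IsTwoFactor 2 (allFin m) cs × (map length cs ↭ L)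

-- a 1-factor of K_m, given by its fixed-point-free involution
-- (x is matched with p x)
IsOneFactor : (m : ℕ) → (Fin m → Fin m) → Set
IsOneFactor m p = (∀ x → p (p x) ≡ x) × (∀ x → p x ≢ x)

multKminus : (m : ℕ) → (Fin m → Fin m) → Fin m → Fin m → ℕ
multKminus m p x y with x ≟ᶠ y | p x ≟ᶠ y
... | Relation.Nullary.yes _ | _                     = 0
... | Relation.Nullary.no _  | Relation.Nullary.yes _ = 0
... | Relation.Nullary.no _  | Relation.Nullary.no _  = 1

multKplus : (m : ℕ) → (Fin m → Fin m) → Fin m → Fin m → ℕ
multKplus m p x y with x ≟ᶠ y | p x ≟ᶠ y
... | Relation.Nullary.yes _ | _                     = 0
... | Relation.Nullary.no _  | Relation.Nullary.yes _ = 2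
... | Relation.Nullary.no _  | Relation.Nullary.no _  = 1

IsFactorization : (m : ℕ) → List ℕ → (Fin m → Fin m → ℕ) → List (List (List (Fin m))) → Set
IsFactorization m L target Fs =
  All (IsFactorOfType m L) Fs ×
  (∀ x y → sum (map (λ F → mult _≟ᶠ_ F x y) Fs) ≡ target x y)

IsPermGroup : (m : ℕ) → List (Permutation′ m) → Set
IsPermGroup m G =
  (∃[ e ] (e ∈ G × (∀ x → e ⟨$⟩ʳ x ≡ x))) ×
  (∀ {g h} → g ∈ G → h ∈ G → ∃[ k ] (k ∈ G × (∀ x → k ⟨$⟩ʳ x ≡ g ⟨$⟩ʳ (h ⟨$⟩ʳ x)))) ×
  (∀ {g} → g ∈ G → ∃[ k ] (k ∈ G × (∀ x → k ⟨$⟩ʳ (g ⟨$⟩ʳ x) ≡ x)))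

IsAutGroup : (m : ℕ) → List (List (List (Fin m))) → List (Permutation′ m) → Set
IsAutGroup m Fs G =
  ∀ {g F} → g ∈ G → F ∈ Fs →
    ∃[ F′ ] (F′ ∈ Fs × (∀ x y → mult _≟ᶠ_ F′ (g ⟨$⟩ʳ x) (g ⟨$⟩ʳ y) ≡ mult _≟ᶠ_ F x y))

FixedBy : {m : ℕ} → List (Permutation′ m) → Fin m → Set
FixedBy G x = All (λ g → g ⟨$⟩ʳ x ≡ x) G

FixesExactlyAndSharplyTransitive : (m f : ℕ) → List (Permutation′ m) → Set
FixesExactlyAndSharplyTransitive m f G =
  (∃[ fs ] (length fs ≡ f × Unique fs × (∀ x → (x ∈ fs → FixedBy G x) × (FixedBy G x → x ∈ fs)))) ×
  (∀ x y → ¬ FixedBy G x → ¬ FixedBy G y →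
     (∃[ g ] (g ∈ G × g ⟨$⟩ʳ x ≡ y)) ×
     (∀ {g g′} → g ∈ G → g′ ∈ G → g ⟨$⟩ʳ x ≡ y → g′ ⟨$⟩ʳ x ≡ y → ∀ z → g ⟨$⟩ʳ z ≡ g′ ⟨$⟩ʳ z))

PyramidalFactorization : (m f : ℕ) → List ℕ → (Fin m → Fin m → ℕ) → Set
PyramidalFactorization m f L target =
  ∃[ Fs ] (IsFactorization m L target Fs ×
    ∃[ G ] (IsPermGroup m G × IsAutGroup m Fs G × FixesExactlyAndSharplyTransitive m f G))

OPminusPyramidal : (m f : ℕ) → List ℕ → Set
OPminusPyramidal m f L = ∃[ p ] (IsOneFactor m p × PyramidalFactorization m f L (multKminus m p))

OPplusPyramidal : (m f : ℕ) → List ℕ → Set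
OPplusPyramidal m f L = ∃[ p ] (IsOneFactor m p × PyramidalFactorization m f L (multKplus m p))

-- 2-starters over Z_{2n}; vertices Maybe (Fin (2n)), nothing = ∞

module _ (n : ℕ) .{{_ : NonZero n}} where

  private instance nz2n = m*n≢0 2 n

  Vtx : Set
  Vtx = Maybe (Fin (2 * n))

  _≟ᵛ_ : DecidableEquality Vtx
  _≟ᵛ_ = ≡-dec _≟ᶠ_

  allVtx : List Vtx
  allVtx = nothing ∷ map just (allFin (2 * n))

  diffZ : Fin (2 * n) → Fin (2 * n) → Fin (2 * n)
  diffZ x y = (toℕ x + (2 * n ∸ toℕ y)) mod (2 * n)

  shiftV : Vtx → Vtx
  shiftV nothing  = nothing
  shiftV (just x) = just ((toℕ x + n) mod (2 * n))

  -- Σ, given as a cycle through ∞ and a list of further cycles, is an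
  -- [ℓ∞, ℓ₁, …, ℓₜ]-starter (ℓs = ℓ₁ … ℓₜ as a multiset)
  record Starter (ℓ∞ : ℕ) (ℓs : List ℕ) : Set where
    field
      cyc∞   : List Vtx
      cycs   : List (List Vtx)
      -- simple 2-regular graph on Z_{2n} ∪ {∞}
      twoReg : IsTwoFactor 3 allVtx (cyc∞ ∷ cycs)
      ∞∈cyc∞ : nothing ∈ cyc∞
      len∞   : length cyc∞ ≡ ℓ∞
      lens   : map length cycs ↭ ℓs
      differences : ∀ (d : Fin (2 * n)) → toℕ d ≢ 0 →
        ∃[ x ] ∃[ y ] (1 ≤ mult _≟ᵛ_ (cyc∞ ∷ cycs) (just x) (just y) × diffZ x y ≡ d)
      invariant : ∀ u v → mult _≟ᵛ_ (cyc∞ ∷ cycs) (shiftV u) (shiftV v) ≡ mult _≟ᵛ_ (cyc∞ ∷ cycs) u v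

module Submission where

-- Write the cycle of Σ through ∞ as ∞ a ⋯ b. As Σ + n = Σ, the neighbours of ∞ are a and b = a + n, and
-- z ↦ z + n maps the path a ⋯ b onto its own reverse, so the path contains consecutive vertices x, x + n.
-- The 2n − 1 edges of Σ inside ℤ₂ₙ realise every difference ±d ≠ 0 at least twice (an edge and its translate
-- by n), hence exactly twice. Closing the path by the edge {b , a} of difference n gives a base 2-factor whose
-- translates by 0, …, n − 1 factorize K₂ₙ + J, J the pairs {z , z + n}; replacing ∞ by ∞₁ and inserting ∞₂
-- between x and x + n gives one whose translates factorize K₂ₙ₊₂ − I, I = J ∪ {∞₁ , ∞₂}. Translation by
-- ℤ₂ₙ permutes these factors, fixes ∞₁ and ∞₂, and is sharply transitive on ℤ₂ₙ.

open import Defs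
open import Algebra.Bundles using (AbelianGroup)
import Algebra.Properties.AbelianGroup as AbelianGroupProperties
import Algebra.Properties.Quasigroup as QuasigroupProperties
open import Algebra.Structures using (IsAbelianGroup)
open import Data.Empty using (⊥-elim)
open import Data.Fin using (Fin; zero; suc; toℕ; splitAt; join; _↑ˡ_; _↑ʳ_)
open import Data.Fin.Permutation using (Permutation′; permutation; _⟨$⟩ʳ_)
open import Data.Fin.Properties using (_≟_; toℕ-injective; toℕ<n; toℕ-fromℕ<; ↑ˡ-injective; splitAt-↑ˡ; splitAt-↑ʳ; splitAt⁻¹-↑ˡ; splitAt⁻¹-↑ʳ)
open import Data.List using (List; []; _∷_; _++_; [_]; zip; map; length; concat; filter; reverse; allFin)
import Data.List.Properties as List
open import Data.List.Membership.Propositional using (_∈_; _∉_; find; lose)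
open import Data.List.Membership.Propositional.Properties using (∈-++⁺ˡ; ∈-++⁺ʳ; ∈-++⁻; ∈-map⁺; ∈-map⁻; ∈-filter⁺; ∈-filter⁻; ∈-allFin; ∈-∃++)
open import Data.List.Membership.Propositional.Properties.WithK using (unique∧set⇒bag)
open import Data.List.Relation.Binary.BagAndSetEquality using (∼bag⇒↭)
open import Data.List.Relation.Binary.Permutation.Propositional using (_↭_; ↭-refl; ↭-reflexive; ↭-sym; ↭-trans; prep; ↭⇒↭ₛ; module PermutationReasoning)
import Data.List.Relation.Binary.Permutation.Propositional.Properties as Perm
import Data.List.Relation.Binary.Permutation.Setoid.Properties as PermSetoid
open import Data.List.Relation.Unary.All using (All; []; _∷_)
import Data.List.Relation.Unary.All as All
import Data.List.Relation.Unary.All.Properties as All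
open import Data.List.Relation.Unary.AllPairs using ([]; _∷_)
open import Data.List.Reverse using (reverseView; []; _∶_∶ʳ_)
open import Data.List.Relation.Unary.Any using (Any; here; there)
open import Data.List.Relation.Unary.Unique.Propositional using (Unique)
import Data.List.Relation.Unary.Unique.Propositional.Properties as Unique
open import Data.List.Relation.Unary.Unique.Propositional.Properties using (Unique[x∷xs]⇒x∉xs)
open import Data.Maybe using (Maybe; just; nothing)
open import Data.Maybe.Properties using (just-injective)
open import Data.Nat using (ℕ; zero; suc; _+_; _*_; _∸_; _≤_; _<_; z≤n; s≤s; s≤s⁻¹; NonZero; _<?_; >-nonZero⁻¹)
open import Data.Nat.DivMod using (_mod_; _%_; m%n<n; %-distribˡ-+; m%n%n≡m%n; m<n⇒m%n≡m; n%n≡0; m≤n⇒[n∸m]%m≡n%m)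
open import Data.Nat.ListAction using (sum)
open import Data.Nat.ListAction.Properties using (sum-++; sum-↭)
open import Data.Nat.Properties
  using ( ≤-refl; ≤-reflexive; ≤-trans; ≤-antisym; ≤-<-trans; <⇒≤; <⇒≱; ≮⇒≥; <-irrefl; 1+n≰n; n≤1+n; m≤m+n; m≤n+m
        ; m<m+n; +-mono-≤; +-monoˡ-≤; +-monoʳ-≤; +-monoˡ-<; +-cancelˡ-≡; +-cancelʳ-≡; +-cancelʳ-≤; +-cancelʳ-<
        ; +-comm; +-assoc; +-suc; +-identityʳ; *-identityˡ; *-zeroʳ; *-suc; *-distribˡ-+; suc-injective; m*n≢0
        ; m∸n≤m; m∸n+n≡m; m+n∸n≡m; m+[n∸m]≡n; ∸-+-assoc; +-commutativeSemigroup; module ≤-Reasoning )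
open import Algebra.Properties.CommutativeSemigroup +-commutativeSemigroup using (interchange)
open import Data.Nat.Solver using (module +-*-Solver)
open +-*-Solver using (solve; _:+_; _:*_; _:=_; con)
open import Data.Product using (∃-syntax; _×_; _,_; proj₁; proj₂)
open import Data.Sum using (_⊎_; inj₁; inj₂; [_,_]′)
import Data.Sum as Sum
open import Data.Unit using (⊤; tt)
open import Function using (_∘_)
open import Function.Bundles using (mk⇔)
open import Relation.Binary using (DecidableEquality)
open import Relation.Binary.PropositionalEquality using (_≡_; _≢_; refl; sym; trans; cong; cong₂; subst; subst₂; setoid; module ≡-Reasoning)
open import Relation.Binary.PropositionalEquality.Algebra using (isMagma)
open import Relation.Nullary using (¬_; Dec; yes; no; _×-dec_; _⊎-dec_)
open import Relation.Unary using (Decidable)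

private variable
  A B : Set
  P P′ Q Q′ : Set

-- Indicators and finite sums

ind : Dec P → ℕ
ind (yes _) = 1
ind (no _)  = 0

ind-yes : (p : Dec P) → P → ind p ≡ 1
ind-yes (yes _) _ = refl
ind-yes (no ¬p) p = ⊥-elim (¬p p)

ind-no : (p : Dec P) → ¬ P → ind p ≡ 0
ind-no (yes p) ¬p = ⊥-elim (¬p p)
ind-no (no _)  _  = refl

ind-pos : (p : Dec P) → 1 ≤ ind p → P
ind-pos (yes p) _ = p

ind-cong : (p : Dec P) (q : Dec Q) → (P → Q) → (Q → P) → ind p ≡ ind q
ind-cong (yes _) (yes _) _ _ = refl
ind-cong (yes p) (no ¬q) f _ = ⊥-elim (¬q (f p))
ind-cong (no ¬p) (yes q) _ g = ⊥-elim (¬p (g q))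
ind-cong (no _)  (no _)  _ _ = refl

ind-⊎ : (p : Dec P) (q : Dec Q) → (P → ¬ Q) → ind (p ⊎-dec q) ≡ ind p + ind q
ind-⊎ (yes p) (yes q) disj = ⊥-elim (disj p q)
ind-⊎ (yes _) (no _)  _    = refl
ind-⊎ (no _)  (yes _) _    = refl
ind-⊎ (no _)  (no _)  _    = refl

ind-⊎-pos : (q : Dec Q) (q′ : Dec Q′) → Q ⊎ Q′ → 1 ≤ ind q + ind q′
ind-⊎-pos q q′ (inj₁ x) = ≤-trans (≤-reflexive (sym (ind-yes q x))) (m≤m+n _ _)
ind-⊎-pos q q′ (inj₂ x) = ≤-trans (≤-reflexive (sym (ind-yes q′ x))) (m≤n+m _ _)

ind-+-mono : (p : Dec P) (p′ : Dec P′) (q : Dec Q) (q′ : Dec Q′) →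
  (P → Q ⊎ Q′) → (P′ → Q ⊎ Q′) → (P → P′ → Q × Q′) → ind p + ind p′ ≤ ind q + ind q′
ind-+-mono (yes p) (yes p′) q q′ _   _   both with x , x′ ← both p p′ =
  ≤-reflexive (sym (cong₂ _+_ (ind-yes q x) (ind-yes q′ x′)))
ind-+-mono (yes p) (no _)   q q′ one _   _    = ind-⊎-pos q q′ (one p)
ind-+-mono (no _)  (yes p′) q q′ _   one _    = ind-⊎-pos q q′ (one p′)
ind-+-mono (no _)  (no _)   _ _  _   _   _    = z≤n

∑ : List A → (A → ℕ) → ℕ
∑ L f = sum (map f L)

∑-++ : (L M : List A) (f : A → ℕ) → ∑ (L ++ M) f ≡ ∑ L f + ∑ M f
∑-++ L M f = trans (cong sum (List.map-++ f L M)) (sum-++ (map f L) (map f M))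

∑-↭ : {L M : List A} (f : A → ℕ) → L ↭ M → ∑ L f ≡ ∑ M f
∑-↭ f L↭M = sum-↭ (Perm.map⁺ f L↭M)

∑-cong : (L : List A) {f g : A → ℕ} → (∀ e → e ∈ L → f e ≡ g e) → ∑ L f ≡ ∑ L g
∑-cong []      _ = refl
∑-cong (x ∷ L) f≡g = cong₂ _+_ (f≡g x (here refl)) (∑-cong L (λ e e∈ → f≡g e (there e∈)))

∑-zero : (L : List A) (f : A → ℕ) → (∀ e → e ∈ L → f e ≡ 0) → ∑ L f ≡ 0
∑-zero []      f _  = refl
∑-zero (x ∷ L) f f≡0 = cong₂ _+_ (f≡0 x (here refl)) (∑-zero L f (λ e e∈ → f≡0 e (there e∈)))

∑-+ : (L : List A) (f g : A → ℕ) → ∑ L (λ e → f e + g e) ≡ ∑ L f + ∑ L g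
∑-+ []      f g = refl
∑-+ (x ∷ L) f g = trans (cong (f x + g x +_) (∑-+ L f g)) (interchange (f x) (g x) (∑ L f) (∑ L g))

∑-* : (L : List A) (k : ℕ) (f : A → ℕ) → ∑ L (λ e → k * f e) ≡ k * ∑ L f
∑-* []      k f = sym (*-zeroʳ k)
∑-* (x ∷ L) k f = trans (cong (k * f x +_) (∑-* L k f)) (sym (*-distribˡ-+ k (f x) (∑ L f)))

∑-const : (L : List A) (k : ℕ) → ∑ L (λ _ → k) ≡ k * length L
∑-const []      k = sym (*-zeroʳ k)
∑-const (_ ∷ L) k = trans (cong (k +_) (∑-const L k)) (sym (*-suc k (length L)))

∑-map : (L : List A) (h : A → B) (f : B → ℕ) → ∑ (map h L) f ≡ ∑ L (λ a → f (h a))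
∑-map []      h f = refl
∑-map (x ∷ L) h f = cong (f (h x) +_) (∑-map L h f)

∑-concat-map : (L : List A) (g : A → List B) (f : B → ℕ) → ∑ (concat (map g L)) f ≡ ∑ L (λ a → ∑ (g a) f)
∑-concat-map []      g f = refl
∑-concat-map (a ∷ L) g f = trans (∑-++ (g a) (concat (map g L)) f) (cong (∑ (g a) f +_) (∑-concat-map L g f))

∑-swap : (L : List A) (M : List B) (f : A → B → ℕ) → ∑ L (λ a → ∑ M (f a)) ≡ ∑ M (λ b → ∑ L (λ a → f a b))
∑-swap []      M f = sym (∑-zero M _ (λ _ _ → refl))
∑-swap (x ∷ L) M f = trans (cong (∑ M (f x) +_) (∑-swap L M f)) (sym (∑-+ M (f x) (λ b → ∑ L (λ a → f a b))))

∑-positive : (L : List A) (f : A → ℕ) → 1 ≤ ∑ L f → ∃[ e ] (e ∈ L × 1 ≤ f e)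
∑-positive (x ∷ L) f pos with f x in eq
... | suc _ = x , here refl , subst (1 ≤_) (sym eq) (s≤s z≤n)
... | zero with ∑-positive L f pos
...   | e , e∈ , fe = e , there e∈ , fe

∑-mono : (L : List A) {f g : A → ℕ} → (∀ e → e ∈ L → f e ≤ g e) → ∑ L f ≤ ∑ L g
∑-mono []      _   = z≤n
∑-mono (x ∷ L) f≤g = +-mono-≤ (f≤g x (here refl)) (∑-mono L (λ e e∈ → f≤g e (there e∈)))

+-tight : ∀ {a b c d} → a ≤ c → b ≤ d → c + d ≡ a + b → c ≡ a × d ≡ b
+-tight {a} {b} {c} {d} a≤c b≤d eq = c≡a , +-cancelˡ-≡ a d b (trans (cong (_+ d) (sym c≡a)) eq)
  where
  c≡a : c ≡ a
  c≡a = ≤-antisym (+-cancelʳ-≤ d c a (≤-trans (≤-reflexive eq) (+-monoʳ-≤ a b≤d))) a≤c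

∑-tight : (L : List A) (f g : A → ℕ) → (∀ e → e ∈ L → g e ≤ f e) → ∑ L f ≡ ∑ L g →
  ∀ e → e ∈ L → f e ≡ g e
∑-tight (x ∷ L) f g g≤f eq = λ where
    e (here refl) → proj₁ tight
    e (there e∈)  → ∑-tight L f g (λ e e∈ → g≤f e (there e∈)) (proj₂ tight) e e∈
  where
  tight : f x ≡ g x × ∑ L f ≡ ∑ L g
  tight = +-tight (g≤f x (here refl)) (∑-mono L (λ e e∈ → g≤f e (there e∈))) eq

∑-ind-≟ : (_≟_ : DecidableEquality A) (L : List A) {x : A} → Unique L → x ∈ L → ∑ L (λ e → ind (e ≟ x)) ≡ 1
∑-ind-≟ _≟_ (y ∷ L) (y∉ ∷ _) (here refl) =
  cong₂ _+_ (ind-yes (y ≟ y) refl) (∑-zero L _ (λ e e∈ → ind-no (e ≟ y) (λ e≡y → All.lookup y∉ e∈ (sym e≡y))))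
∑-ind-≟ _≟_ (y ∷ L) (y∉ ∷ u) (there x∈) =
  cong₂ _+_ (ind-no (y ≟ _) (All.lookup y∉ x∈)) (∑-ind-≟ _≟_ L u x∈)

∑-ind-at-most-one : (_≟_ : DecidableEquality A) (L : List A) {R : A → Set} (R? : Decidable R) (t₀ : A) (q : Dec Q) →
  Unique L → t₀ ∈ L → (∀ t → R t → t ≡ t₀ × Q) → (Q → R t₀) → ∑ L (λ t → ind (R? t)) ≡ ind q
∑-ind-at-most-one _≟_ L R? t₀ (yes q) u t₀∈ only at =
  trans (∑-cong L (λ t _ → ind-cong (R? t) (t ≟ t₀) (λ r → proj₁ (only t r)) (λ { refl → at q }))) (∑-ind-≟ _≟_ L u t₀∈)
∑-ind-at-most-one _≟_ L R? t₀ (no ¬q) _ _ only _ =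
  ∑-zero L _ (λ t _ → ind-no (R? t) (λ r → ¬q (proj₂ (only t r))))

length-filter : {P : A → Set} (P? : Decidable P) (L : List A) → length (filter P? L) ≡ ∑ L (λ e → ind (P? e))
length-filter P? []      = refl
length-filter P? (x ∷ L) with P? x
... | yes _ = cong suc (length-filter P? L)
... | no _  = length-filter P? L

unique-⇔⇒↭ : {xs ys : List A} → Unique xs → Unique ys →
  (∀ z → z ∈ xs → z ∈ ys) → (∀ z → z ∈ ys → z ∈ xs) → xs ↭ ys
unique-⇔⇒↭ uxs uys to from = ∼bag⇒↭ (unique∧set⇒bag uxs uys (mk⇔ (to _) (from _)))

Unique-resp-↭ : {xs ys : List A} → xs ↭ ys → Unique xs → Unique ys
Unique-resp-↭ {A = A} xs↭ys = PermSetoid.Unique-resp-↭ (setoid A) (↭⇒↭ₛ xs↭ys)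

Unique-++⁻ˡ : (xs : List A) {ys : List A} → Unique (xs ++ ys) → Unique xs
Unique-++⁻ˡ []       _         = []
Unique-++⁻ˡ (x ∷ xs) (x∉ ∷ u) = All.++⁻ˡ xs x∉ ∷ Unique-++⁻ˡ xs u

Unique-++⁻ʳ : (xs : List A) {ys : List A} → Unique (xs ++ ys) → Unique ys
Unique-++⁻ʳ []       u       = u
Unique-++⁻ʳ (x ∷ xs) (_ ∷ u) = Unique-++⁻ʳ xs u

Unique-++⇒disjoint : (xs : List A) {ys : List A} → Unique (xs ++ ys) → ∀ {z} → z ∈ xs → z ∉ ys
Unique-++⇒disjoint (x ∷ xs) (x∉ ∷ _) (here refl) z∈ys = All.lookup (All.++⁻ʳ xs x∉) z∈ys refl
Unique-++⇒disjoint (x ∷ xs) (_ ∷ u)  (there z∈)  z∈ys = Unique-++⇒disjoint xs u z∈ z∈ys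

map-inverse-allFin-↭ : {m : ℕ} (f g : Fin m → Fin m) → (∀ x → g (f x) ≡ x) → (∀ x → f (g x) ≡ x) →
  map f (allFin m) ↭ allFin m
map-inverse-allFin-↭ {m} f g gf fg = unique-⇔⇒↭ (Unique.map⁺ f-injective (Unique.allFin⁺ m)) (Unique.allFin⁺ m)
  (λ z _ → ∈-allFin z) (λ z _ → subst (_∈ map f (allFin m)) (fg z) (∈-map⁺ f (∈-allFin (g z))))
  where
  f-injective : ∀ {x y} → f x ≡ f y → x ≡ y
  f-injective {x} {y} eq = trans (sym (gf x)) (trans (cong g eq) (gf y))

map-just-view : (l : List (Maybe A)) → (∀ v → v ∈ l → ∃[ x ] (v ≡ just x)) → ∃[ l′ ] (l ≡ map just l′)
map-just-view []      _     = [] , refl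
map-just-view (v ∷ l) finite with finite v (here refl) | map-just-view l (λ u u∈ → finite u (there u∈))
... | x , refl | l′ , refl = x ∷ l′ , refl

map-map-just-view : (ls : List (List (Maybe A))) → (∀ v → v ∈ concat ls → ∃[ x ] (v ≡ just x)) →
  ∃[ ls′ ] (ls ≡ map (map just) ls′)
map-map-just-view []       _      = [] , refl
map-map-just-view (l ∷ ls) finite
  with map-just-view l (λ v v∈ → finite v (∈-++⁺ˡ v∈)) | map-map-just-view ls (λ v v∈ → finite v (∈-++⁺ʳ l v∈))
... | l′ , refl | ls′ , refl = l′ ∷ ls′ , refl

-- Paths, cycles and their edges

both : (A → B) → A × A → B × B
both f (a , b) = (f a , f b)

pathEdges : A → List A → List (A × A)
pathEdges x []       = []
pathEdges x (y ∷ ys) = (x , y) ∷ pathEdges y ys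

pathEnd : A → List A → A
pathEnd x []       = x
pathEnd x (y ∷ ys) = pathEnd y ys

edges : List (List A) → List (A × A)
edges cs = concat (map cycleEdges cs)

pathEdges-++ : (x : A) (ys zs : List A) → pathEdges x (ys ++ zs) ≡ pathEdges x ys ++ pathEdges (pathEnd x ys) zs
pathEdges-++ x []       zs = refl
pathEdges-++ x (y ∷ ys) zs = cong ((x , y) ∷_) (pathEdges-++ y ys zs)

pathEnd-++ : (x : A) (ys zs : List A) → pathEnd x (ys ++ zs) ≡ pathEnd (pathEnd x ys) zs
pathEnd-++ x []       zs = refl
pathEnd-++ x (y ∷ ys) zs = pathEnd-++ y ys zs

pathEdges-map : (f : A → B) (x : A) (ys : List A) → pathEdges (f x) (map f ys) ≡ map (both f) (pathEdges x ys)
pathEdges-map f x []       = refl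
pathEdges-map f x (y ∷ ys) = cong ((f x , f y) ∷_) (pathEdges-map f y ys)

pathEnd-map : (f : A → B) (x : A) (ys : List A) → pathEnd (f x) (map f ys) ≡ f (pathEnd x ys)
pathEnd-map f x []       = refl
pathEnd-map f x (y ∷ ys) = pathEnd-map f y ys

pathEnd-∈ : (x : A) (ys : List A) → ys ≢ [] → pathEnd x ys ∈ ys
pathEnd-∈ x []           ys≢[] = ⊥-elim (ys≢[] refl)
pathEnd-∈ x (y ∷ [])     _     = here refl
pathEnd-∈ x (y ∷ z ∷ ys) _     = there (pathEnd-∈ y (z ∷ ys) (λ ()))

length-pathEdges : (x : A) (ys : List A) → length (pathEdges x ys) ≡ length ys
length-pathEdges x []       = refl
length-pathEdges x (y ∷ ys) = cong suc (length-pathEdges y ys)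

cycleEdges-∷ : (x : A) (xs : List A) → cycleEdges (x ∷ xs) ≡ pathEdges x xs ++ [ (pathEnd x xs , x) ]
cycleEdges-∷ {A = A} x xs = trans (zip≡pathEdges x xs) (pathEdges-++ x xs [ x ])
  where
  zip≡pathEdges : (y : A) (ys : List A) → zip (y ∷ ys) (ys ++ [ x ]) ≡ pathEdges y (ys ++ [ x ])
  zip≡pathEdges y []       = refl
  zip≡pathEdges y (z ∷ ys) = cong ((y , z) ∷_) (zip≡pathEdges z ys)

cycleEdges-map : (f : A → B) (c : List A) → cycleEdges (map f c) ≡ map (both f) (cycleEdges c)
cycleEdges-map f []       = refl
cycleEdges-map f (x ∷ xs) = begin
  cycleEdges (f x ∷ map f xs)
    ≡⟨ cycleEdges-∷ (f x) (map f xs) ⟩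
  pathEdges (f x) (map f xs) ++ [ (pathEnd (f x) (map f xs) , f x) ]
    ≡⟨ cong₂ (λ p e → p ++ [ (e , f x) ]) (pathEdges-map f x xs) (pathEnd-map f x xs) ⟩
  map (both f) (pathEdges x xs) ++ map (both f) [ (pathEnd x xs , x) ]
    ≡⟨ sym (List.map-++ (both f) (pathEdges x xs) _) ⟩
  map (both f) (pathEdges x xs ++ [ (pathEnd x xs , x) ])
    ≡⟨ cong (map (both f)) (sym (cycleEdges-∷ x xs)) ⟩
  map (both f) (cycleEdges (x ∷ xs)) ∎
  where open ≡-Reasoning

edges-map : (f : A → B) (cs : List (List A)) → edges (map (map f) cs) ≡ map (both f) (edges cs)
edges-map f []       = refl
edges-map f (c ∷ cs) = trans (cong₂ _++_ (cycleEdges-map f c) (edges-map f cs))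
                             (sym (List.map-++ (both f) (cycleEdges c) (edges cs)))

length-cycleEdges : (c : List A) → length (cycleEdges c) ≡ length c
length-cycleEdges []       = refl
length-cycleEdges (x ∷ xs) = begin
  length (cycleEdges (x ∷ xs))                    ≡⟨ cong length (cycleEdges-∷ x xs) ⟩
  length (pathEdges x xs ++ [ (pathEnd x xs , x) ]) ≡⟨ List.length-++ (pathEdges x xs) ⟩
  length (pathEdges x xs) + 1                      ≡⟨ cong (_+ 1) (length-pathEdges x xs) ⟩
  length xs + 1                                    ≡⟨ +-comm (length xs) 1 ⟩
  suc (length xs)                                  ∎
  where open ≡-Reasoning

length-edges : (cs : List (List A)) → length (edges cs) ≡ length (concat cs)
length-edges []       = refl
length-edges (c ∷ cs) = begin
  length (cycleEdges c ++ edges cs)          ≡⟨ List.length-++ (cycleEdges c) ⟩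
  length (cycleEdges c) + length (edges cs)  ≡⟨ cong₂ _+_ (length-cycleEdges c) (length-edges cs) ⟩
  length c + length (concat cs)              ≡⟨ List.length-++ c ⟨
  length (c ++ concat cs)                    ∎
  where open ≡-Reasoning

cycleEdges-rotate : (p c : List A) → cycleEdges (p ++ c) ↭ cycleEdges (c ++ p)
cycleEdges-rotate []      c = ↭-reflexive (cong cycleEdges (sym (List.++-identityʳ c)))
cycleEdges-rotate (y ∷ p) c = begin
  cycleEdges (y ∷ p ++ c)        ↭⟨ rotate-head y (p ++ c) ⟩
  cycleEdges ((p ++ c) ++ [ y ]) ≡⟨ cong cycleEdges (List.++-assoc p c [ y ]) ⟩
  cycleEdges (p ++ c ++ [ y ])   ↭⟨ cycleEdges-rotate p (c ++ [ y ]) ⟩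
  cycleEdges ((c ++ [ y ]) ++ p) ≡⟨ cong cycleEdges (List.++-assoc c [ y ] p) ⟩
  cycleEdges (c ++ y ∷ p)        ∎
  where
  open PermutationReasoning
  rotate-head : (a : A) (l : List A) → cycleEdges (a ∷ l) ↭ cycleEdges (l ++ [ a ])
  rotate-head a []      = ↭-refl
  rotate-head a (b ∷ l) = begin
    cycleEdges (a ∷ b ∷ l)                                             ≡⟨ cycleEdges-∷ a (b ∷ l) ⟩
    (a , b) ∷ pathEdges b l ++ [ (pathEnd b l , a) ]                   ↭⟨ Perm.∷↭∷ʳ (a , b) _ ⟩
    (pathEdges b l ++ [ (pathEnd b l , a) ]) ++ [ (a , b) ]           ≡⟨ cong₂ (λ p e → p ++ [ (e , b) ])
                                                                          (sym (pathEdges-++ b l [ a ])) (sym (pathEnd-++ b l [ a ])) ⟩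
    pathEdges b (l ++ [ a ]) ++ [ (pathEnd b (l ++ [ a ]) , b) ]       ≡⟨ cycleEdges-∷ b (l ++ [ a ]) ⟨
    cycleEdges (b ∷ l ++ [ a ])                                        ∎

∈-pathEdges⇒∈ : (x : A) (l : List A) {u v : A} → (u , v) ∈ pathEdges x l → u ∈ x ∷ l × v ∈ x ∷ l
∈-pathEdges⇒∈ x (y ∷ l) (here refl) = here refl , there (here refl)
∈-pathEdges⇒∈ x (y ∷ l) (there e∈) with u∈ , v∈ ← ∈-pathEdges⇒∈ y l e∈ = there u∈ , there v∈

∈-cycleEdges⇒∈ : (c : List A) {u v : A} → (u , v) ∈ cycleEdges c → u ∈ c × v ∈ c
∈-cycleEdges⇒∈ (x ∷ l) e∈ with ∈-++⁻ (pathEdges x l) (subst ((_ , _) ∈_) (cycleEdges-∷ x l) e∈)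
... | inj₁ e∈p          = ∈-pathEdges⇒∈ x l e∈p
... | inj₂ (here refl) = pathEnd∈ x l , here refl
  where
  pathEnd∈ : (x : A) (l : List A) → pathEnd x l ∈ x ∷ l
  pathEnd∈ x []      = here refl
  pathEnd∈ x (y ∷ l) = there (pathEnd∈ y l)

∈-edges⇒∈ : (cs : List (List A)) {u v : A} → (u , v) ∈ edges cs → u ∈ concat cs × v ∈ concat cs
∈-edges⇒∈ (c ∷ cs) e∈ with ∈-++⁻ (cycleEdges c) e∈
... | inj₁ e∈c with u∈ , v∈ ← ∈-cycleEdges⇒∈ c e∈c  = ∈-++⁺ˡ u∈ , ∈-++⁺ˡ v∈
... | inj₂ e∈cs with u∈ , v∈ ← ∈-edges⇒∈ cs e∈cs   = ∈-++⁺ʳ c u∈ , ∈-++⁺ʳ c v∈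

∈-pathEdges⇒infix : (x : A) (l : List A) {u v : A} → (u , v) ∈ pathEdges x l → ∃[ P ] ∃[ Q ] (x ∷ l ≡ P ++ u ∷ v ∷ Q)
∈-pathEdges⇒infix x (y ∷ l) (here refl) = [] , l , refl
∈-pathEdges⇒infix x (y ∷ l) (there e∈) with P , Q , eq ← ∈-pathEdges⇒infix y l e∈ = x ∷ P , Q , cong (x ∷_) eq

infix⇒∈-pathEdges : (x : A) (l : List A) {u v : A} (P Q : List A) → x ∷ l ≡ P ++ u ∷ v ∷ Q → (u , v) ∈ pathEdges x l
infix⇒∈-pathEdges x (y ∷ l) []      Q refl = here refl
infix⇒∈-pathEdges x (y ∷ l) (p ∷ P) Q eq   = there (infix⇒∈-pathEdges y l P Q (proj₂ (List.∷-injective eq)))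
infix⇒∈-pathEdges x []      (p ∷ []) Q ()
infix⇒∈-pathEdges x []      (p ∷ _ ∷ P) Q ()

pathEdges-irrefl : (x : A) (l : List A) → Unique (x ∷ l) → ∀ {u v} → (u , v) ∈ pathEdges x l → u ≢ v
pathEdges-irrefl x (y ∷ l) (x∉ ∷ _) (here refl) = All.head x∉
pathEdges-irrefl x (y ∷ l) (_ ∷ u)  (there e∈)  = pathEdges-irrefl y l u e∈

cycleEdges-irrefl : (c : List A) → Unique c → 2 ≤ length c → ∀ {u v} → (u , v) ∈ cycleEdges c → u ≢ v
cycleEdges-irrefl (x ∷ l) u len e∈ with ∈-++⁻ (pathEdges x l) (subst ((_ , _) ∈_) (cycleEdges-∷ x l) e∈)
... | inj₁ e∈p         = pathEdges-irrefl x l u e∈p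
... | inj₂ (here refl) = λ end≡x → Unique[x∷xs]⇒x∉xs u (subst (_∈ l) end≡x (pathEnd-∈ x l l≢[]))
  where
  l≢[] : l ≢ []
  l≢[] refl = 1+n≰n len

edges-irrefl : (cs : List (List A)) → Unique (concat cs) → All (λ c → 2 ≤ length c) cs →
  ∀ {u v} → (u , v) ∈ edges cs → u ≢ v
edges-irrefl (c ∷ cs) u (len ∷ lens) e∈ with ∈-++⁻ (cycleEdges c) e∈
... | inj₁ e∈c  = cycleEdges-irrefl c (Unique-++⁻ˡ c u) len e∈c
... | inj₂ e∈cs = edges-irrefl cs (Unique-++⁻ʳ c u) lens e∈cs

Joins : A → A → A × A → Set
Joins x y e = (proj₁ e ≡ x × proj₂ e ≡ y) ⊎ (proj₁ e ≡ y × proj₂ e ≡ x)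

Joins-sym : {x y : A} (e : A × A) → Joins x y e → Joins y x e
Joins-sym e (inj₁ (e₁ , e₂)) = inj₂ (e₁ , e₂)
Joins-sym e (inj₂ (e₁ , e₂)) = inj₁ (e₁ , e₂)

walk-along-path : (x : A) (r s : List A) → Unique (x ∷ r) → Unique (x ∷ s) → length s ≡ length r →
  (∀ u v → (u , v) ∈ pathEdges x s → u ∈ x ∷ r → Any (Joins u v) (pathEdges x r)) → s ≡ r
walk-along-path x []      []      _  _  _   _    = refl
walk-along-path x (z ∷ r) (y ∷ s) ur us len step with step x y (here refl) (here refl)
... | here (inj₁ (_ , refl)) =
  cong (z ∷_) (walk-along-path z r s (Unique-tail ur) (Unique-tail us) (suc-injective len) step′)
  where
  Unique-tail : ∀ {w : A} {ws} → Unique (w ∷ ws) → Unique ws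
  Unique-tail (_ ∷ u) = u
  step′ : ∀ u v → (u , v) ∈ pathEdges z s → u ∈ z ∷ r → Any (Joins u v) (pathEdges z r)
  step′ u v e∈ u∈ with step u v (there e∈) (there u∈)
  ... | here (inj₁ (refl , _)) = ⊥-elim (Unique[x∷xs]⇒x∉xs us (proj₁ (∈-pathEdges⇒∈ z s e∈)))
  ... | here (inj₂ (refl , _)) = ⊥-elim (Unique[x∷xs]⇒x∉xs us (proj₂ (∈-pathEdges⇒∈ z s e∈)))
  ... | there j                = j
... | here (inj₂ (refl , _)) = ⊥-elim (Unique[x∷xs]⇒x∉xs us (here refl))
... | there j with find j
...   | _ , e∈ , inj₁ (refl , _) = ⊥-elim (Unique[x∷xs]⇒x∉xs ur (proj₁ (∈-pathEdges⇒∈ z r e∈)))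
...   | _ , e∈ , inj₂ (_ , refl) = ⊥-elim (Unique[x∷xs]⇒x∉xs ur (proj₂ (∈-pathEdges⇒∈ z r e∈)))

reverse-∷ : (x : A) (l : List A) → ∃[ r ] (reverse (x ∷ l) ≡ pathEnd x l ∷ r × length r ≡ length l)
reverse-∷ x []      = [] , refl , refl
reverse-∷ x (y ∷ l) with r , rev≡ , len ← reverse-∷ y l = r ++ [ x ] , eq , length-r++[x]
  where
  eq : reverse (x ∷ y ∷ l) ≡ pathEnd y l ∷ r ++ [ x ]
  eq = trans (List.unfold-reverse x (y ∷ l)) (cong (_++ [ x ]) rev≡)
  length-r++[x] : length (r ++ [ x ]) ≡ suc (length l)
  length-r++[x] = trans (List.length-++ r) (trans (+-comm (length r) 1) (cong suc len))

∈-pathEdges-reverse : (x : A) (l : List A) (y : A) (r : List A) → reverse (x ∷ l) ≡ y ∷ r →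
  ∀ {u v} → (u , v) ∈ pathEdges y r → (v , u) ∈ pathEdges x l
∈-pathEdges-reverse x l y r rev≡ {u} {v} e∈ with P , Q , y∷r≡ ← ∈-pathEdges⇒infix y r e∈ =
  infix⇒∈-pathEdges x l (reverse Q) (reverse P) x∷l≡
  where
  open ≡-Reasoning
  x∷l≡ : x ∷ l ≡ reverse Q ++ v ∷ u ∷ reverse P
  x∷l≡ = begin
    x ∷ l                                         ≡⟨ List.reverse-involutive (x ∷ l) ⟨
    reverse (reverse (x ∷ l))                     ≡⟨ cong reverse (trans rev≡ y∷r≡) ⟩
    reverse (P ++ u ∷ v ∷ Q)                      ≡⟨ List.reverse-++ P (u ∷ v ∷ Q) ⟩
    reverse (u ∷ v ∷ Q) ++ reverse P              ≡⟨ cong (_++ reverse P) (List.unfold-reverse u (v ∷ Q)) ⟩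
    (reverse (v ∷ Q) ++ [ u ]) ++ reverse P       ≡⟨ cong (λ t → (t ++ [ u ]) ++ reverse P) (List.unfold-reverse v Q) ⟩
    ((reverse Q ++ [ v ]) ++ [ u ]) ++ reverse P  ≡⟨ List.++-assoc (reverse Q ++ [ v ]) [ u ] (reverse P) ⟩
    (reverse Q ++ [ v ]) ++ u ∷ reverse P         ≡⟨ List.++-assoc (reverse Q) [ v ] (u ∷ reverse P) ⟩
    reverse Q ++ v ∷ u ∷ reverse P                ∎

reverse-map-adjacent : (f : A → A) → (∀ a → f a ≢ a) → (l : List A) → l ≢ [] →
  l ≡ reverse (map f l) → ∃[ P ] ∃[ Q ] ∃[ x ] (l ≡ P ++ x ∷ f x ∷ Q)
reverse-map-adjacent {A = A} f no-fix l = go (length l) l ≤-refl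
  where
  reverse-map-∷ʳ : (m : List A) (y : A) → reverse (map f (m ++ [ y ])) ≡ f y ∷ reverse (map f m)
  reverse-map-∷ʳ m y = begin
    reverse (map f (m ++ [ y ]))     ≡⟨ cong reverse (List.map-++ f m [ y ]) ⟩
    reverse (map f m ++ [ f y ])     ≡⟨ List.reverse-++ (map f m) [ f y ] ⟩
    f y ∷ reverse (map f m)          ∎
    where open ≡-Reasoning

  go : (k : ℕ) (l : List A) → length l ≤ k → l ≢ [] → l ≡ reverse (map f l) →
    ∃[ P ] ∃[ Q ] ∃[ x ] (l ≡ P ++ x ∷ f x ∷ Q)
  go k       []      _   l≢[] _  = ⊥-elim (l≢[] refl)
  go zero    (x ∷ l) ()
  go (suc k) (x ∷ l) len _    eq with reverseView l
  ... | [] = ⊥-elim (no-fix x (sym (proj₁ (List.∷-injective eq))))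
  ... | m ∶ _ ∶ʳ y
    with _ , eq′ ← List.∷-injective (trans eq (trans (List.unfold-reverse (f x) (map f (m ++ [ y ])))
                                                        (cong (_++ [ f x ]) (reverse-map-∷ʳ m y))))
    with m≡ , refl ← List.∷ʳ-injective m (reverse (map f m)) eq′
    with m
  ...   | []     = [] , [] , x , refl
  ...   | z ∷ m′
    with P , Q , w , eqm ← go k (z ∷ m′) (≤-trans (m≤m+n _ 1) (≤-trans (≤-reflexive (sym (List.length-++ (z ∷ m′)))) (s≤s⁻¹ len)))
                                (λ ()) m≡
    = x ∷ P , Q ++ [ f x ] , w
    , cong (x ∷_) (trans (cong (_++ [ f x ]) eqm) (List.++-assoc P (w ∷ f w ∷ Q) [ f x ]))

-- Counting edges

module EdgeCount {V : Set} (_≟_ : DecidableEquality V) where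

  joins? : (x y : V) (e : V × V) → Dec (Joins x y e)
  joins? x y e = ((proj₁ e ≟ x) ×-dec (proj₂ e ≟ y)) ⊎-dec ((proj₁ e ≟ y) ×-dec (proj₂ e ≟ x))

  edgeCount : List (V × V) → V → V → ℕ
  edgeCount L x y = ∑ L (λ e → ind (joins? x y e))

  mult≡edgeCount : (cs : List (List V)) (x y : V) → mult _≟_ cs x y ≡ edgeCount (edges cs) x y
  mult≡edgeCount cs x y = trans (∑-cong cs (λ c _ → cycleMult≡ c)) (sym (∑-concat-map cs cycleEdges _))
    where
    cycleMult≡ : (c : List V) → cycleMult _≟_ c x y ≡ edgeCount (cycleEdges c) x y
    cycleMult≡ c = trans (length-filter _ (cycleEdges c)) (∑-cong (cycleEdges c) (λ { (a , b) _ → refl }))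

  edgeCount-↭ : {L M : List (V × V)} (x y : V) → L ↭ M → edgeCount L x y ≡ edgeCount M x y
  edgeCount-↭ x y = ∑-↭ _

  edgeCount-sym : (L : List (V × V)) (x y : V) → edgeCount L x y ≡ edgeCount L y x
  edgeCount-sym L x y = ∑-cong L (λ e _ → ind-cong (joins? x y e) (joins? y x e) (Joins-sym e) (Joins-sym e))

  edgeCount-positive : (L : List (V × V)) (x y : V) → 1 ≤ edgeCount L x y → ∃[ e ] (e ∈ L × Joins x y e)
  edgeCount-positive L x y pos with e , e∈ , je ← ∑-positive L _ pos = e , e∈ , ind-pos (joins? x y e) je

  edgeCount-zero : (L : List (V × V)) (x y : V) → (∀ e → e ∈ L → ¬ Joins x y e) → edgeCount L x y ≡ 0
  edgeCount-zero L x y none = ∑-zero L _ (λ e e∈ → ind-no (joins? x y e) (none e e∈))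

  edgeCount-irrefl : (L : List (V × V)) → (∀ {u v} → (u , v) ∈ L → u ≢ v) → (x : V) → edgeCount L x x ≡ 0
  edgeCount-irrefl L irrefl x = edgeCount-zero L x x λ
    { (u , v) e∈ (inj₁ (refl , refl)) → irrefl e∈ refl
    ; (u , v) e∈ (inj₂ (refl , refl)) → irrefl e∈ refl }

  ∈⇒edgeCount-pos : (L : List (V × V)) (x y : V) → (x , y) ∈ L → 1 ≤ edgeCount L x y
  ∈⇒edgeCount-pos (_ ∷ L) x y (here refl) = ≤-trans (≤-reflexive (sym (ind-yes (joins? x y (x , y)) (inj₁ (refl , refl))))) (m≤m+n _ _)
  ∈⇒edgeCount-pos (e ∷ L) x y (there e∈)  = ≤-trans (∈⇒edgeCount-pos L x y e∈) (m≤n+m _ _)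

  neighbours-of-apex : (w u u′ y : V) (M : List (V × V)) → (∀ e → e ∈ M → proj₁ e ≢ w × proj₂ e ≢ w) →
    1 ≤ edgeCount ((w , u) ∷ (u′ , w) ∷ M) w y → y ≡ u ⊎ y ≡ u′
  neighbours-of-apex w u u′ y M w∉M pos with edgeCount-positive ((w , u) ∷ (u′ , w) ∷ M) w y pos
  ... | _ , here refl , inj₁ (_ , u≡y)                = inj₁ (sym u≡y)
  ... | _ , here refl , inj₂ (w≡y , u≡w)              = inj₁ (trans (sym w≡y) (sym u≡w))
  ... | _ , there (here refl) , inj₁ (u′≡w , w≡y)     = inj₂ (trans (sym w≡y) (sym u′≡w))
  ... | _ , there (here refl) , inj₂ (u′≡y , _)       = inj₂ (sym u′≡y)
  ... | e , there (there e∈) , inj₁ (e₁≡w , _)        = ⊥-elim (proj₁ (w∉M e e∈) e₁≡w)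
  ... | e , there (there e∈) , inj₂ (_ , e₂≡w)        = ⊥-elim (proj₂ (w∉M e e∈) e₂≡w)

module EdgeCountMap {V W : Set} (_≟V_ : DecidableEquality V) (_≟W_ : DecidableEquality W) where
  open EdgeCount _≟V_ using () renaming (edgeCount to edgeCountV; joins? to joinsV?)
  open EdgeCount _≟W_ using () renaming (edgeCount to edgeCountW; joins? to joinsW?)

  edgeCount-map-injective : (f : V → W) → (∀ {a b} → f a ≡ f b → a ≡ b) →
    (L : List (V × V)) (x y : V) → edgeCountW (map (both f) L) (f x) (f y) ≡ edgeCountV L x y
  edgeCount-map-injective f inj L x y = trans (∑-map L (both f) _) (∑-cong L λ { (a , b) _ →
    ind-cong (joinsW? (f x) (f y) (f a , f b)) (joinsV? x y (a , b)) reflect preserve })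
    where
    reflect : ∀ {a b} → Joins (f x) (f y) (f a , f b) → Joins x y (a , b)
    reflect (inj₁ (p , q)) = inj₁ (inj p , inj q)
    reflect (inj₂ (p , q)) = inj₂ (inj p , inj q)
    preserve : ∀ {a b} → Joins x y (a , b) → Joins (f x) (f y) (f a , f b)
    preserve (inj₁ (p , q)) = inj₁ (cong f p , cong f q)
    preserve (inj₂ (p , q)) = inj₂ (cong f p , cong f q)

  edgeCount-map-outside : (f : V → W) (L : List (V × V)) (X Y : W) → (∀ a → f a ≢ X) →
    edgeCountW (map (both f) L) X Y ≡ 0
  edgeCount-map-outside f L X Y X∉img = trans (∑-map L (both f) _) (∑-zero L _ λ { (a , b) _ →
    ind-no (joinsW? X Y (f a , f b)) λ { (inj₁ (p , _)) → X∉img a p ; (inj₂ (_ , q)) → X∉img b q } })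

module Cyclic (n : ℕ) .{{_ : NonZero n}} where

  instance
    nonZero-2n : NonZero (2 * n)
    nonZero-2n = m*n≢0 2 n

  Z : Set
  Z = Fin (2 * n)

  infixl 6 _⊕_ _-_
  infix  8 ⊖_

  _⊕_ : Z → Z → Z
  a ⊕ b = (toℕ a + toℕ b) mod (2 * n)

  ⊖_ : Z → Z
  ⊖ a = (2 * n ∸ toℕ a) mod (2 * n)

  _-_ : Z → Z → Z
  a - b = a ⊕ ⊖ b

  𝟎 : Z
  𝟎 = 0 mod (2 * n)

  ν : Z
  ν = n mod (2 * n)

  private
    toℕ-mod : ∀ m → toℕ (m mod (2 * n)) ≡ m % (2 * n)
    toℕ-mod m = toℕ-fromℕ< (m%n<n m (2 * n))

    %-≡⇒mod-≡ : ∀ a b → a % (2 * n) ≡ b % (2 * n) → a mod (2 * n) ≡ b mod (2 * n)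
    %-≡⇒mod-≡ a b eq = toℕ-injective (trans (toℕ-mod a) (trans eq (sym (toℕ-mod b))))

    %-absorbˡ : ∀ x y → (x % (2 * n) + y) % (2 * n) ≡ (x + y) % (2 * n)
    %-absorbˡ x y = begin
      (x % (2 * n) + y) % (2 * n)                     ≡⟨ %-distribˡ-+ (x % (2 * n)) y (2 * n) ⟩
      (x % (2 * n) % (2 * n) + y % (2 * n)) % (2 * n) ≡⟨ cong (λ t → (t + y % (2 * n)) % (2 * n)) (m%n%n≡m%n x (2 * n)) ⟩
      (x % (2 * n) + y % (2 * n)) % (2 * n)           ≡⟨ %-distribˡ-+ x y (2 * n) ⟨
      (x + y) % (2 * n)                               ∎
      where open ≡-Reasoning

    %-absorbʳ : ∀ x y → (x + y % (2 * n)) % (2 * n) ≡ (x + y) % (2 * n)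
    %-absorbʳ x y = trans (cong (_% (2 * n)) (+-comm x _)) (trans (%-absorbˡ y x) (cong (_% (2 * n)) (+-comm y x)))

    toℕ-𝟎 : toℕ 𝟎 ≡ 0
    toℕ-𝟎 = trans (toℕ-mod 0) (m<n⇒m%n≡m (>-nonZero⁻¹ (2 * n)))

    toℕ-ν : toℕ ν ≡ n
    toℕ-ν = trans (toℕ-mod n) (m<n⇒m%n≡m n<2n)
      where
      n<2n : n < 2 * n
      n<2n = subst (n <_) (cong (n +_) (sym (+-identityʳ n))) (m<m+n n (>-nonZero⁻¹ n))

    2n≡n+n : 2 * n ≡ n + n
    2n≡n+n = cong (n +_) (+-identityʳ n)

  ⊕-comm : ∀ a b → a ⊕ b ≡ b ⊕ a
  ⊕-comm a b = cong (_mod (2 * n)) (+-comm (toℕ a) (toℕ b))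

  ⊕-assoc : ∀ a b c → a ⊕ b ⊕ c ≡ a ⊕ (b ⊕ c)
  ⊕-assoc a b c = %-≡⇒mod-≡ _ _ (begin
    (toℕ (a ⊕ b) + toℕ c) % (2 * n)         ≡⟨ cong (λ t → (t + toℕ c) % (2 * n)) (toℕ-mod (toℕ a + toℕ b)) ⟩
    ((toℕ a + toℕ b) % (2 * n) + toℕ c) % (2 * n) ≡⟨ %-absorbˡ (toℕ a + toℕ b) (toℕ c) ⟩
    (toℕ a + toℕ b + toℕ c) % (2 * n)       ≡⟨ cong (_% (2 * n)) (+-assoc (toℕ a) (toℕ b) (toℕ c)) ⟩
    (toℕ a + (toℕ b + toℕ c)) % (2 * n)     ≡⟨ %-absorbʳ (toℕ a) (toℕ b + toℕ c) ⟨
    (toℕ a + (toℕ b + toℕ c) % (2 * n)) % (2 * n) ≡⟨ cong (λ t → (toℕ a + t) % (2 * n)) (toℕ-mod (toℕ b + toℕ c)) ⟨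
    (toℕ a + toℕ (b ⊕ c)) % (2 * n)         ∎)
    where open ≡-Reasoning

  ⊕-identityʳ : ∀ a → a ⊕ 𝟎 ≡ a
  ⊕-identityʳ a = toℕ-injective (begin
    toℕ (a ⊕ 𝟎)                             ≡⟨ toℕ-mod _ ⟩
    (toℕ a + toℕ 𝟎) % (2 * n)               ≡⟨ cong (λ t → (toℕ a + t) % (2 * n)) toℕ-𝟎 ⟩
    (toℕ a + 0) % (2 * n)                   ≡⟨ cong (_% (2 * n)) (+-identityʳ (toℕ a)) ⟩
    toℕ a % (2 * n)                         ≡⟨ m<n⇒m%n≡m (toℕ<n a) ⟩
    toℕ a                                   ∎)
    where open ≡-Reasoning

  ⊕-inverseʳ : ∀ a → a ⊕ ⊖ a ≡ 𝟎
  ⊕-inverseʳ a = %-≡⇒mod-≡ _ _ (begin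
    (toℕ a + toℕ (⊖ a)) % (2 * n)           ≡⟨ cong (λ t → (toℕ a + t) % (2 * n)) (toℕ-mod (2 * n ∸ toℕ a)) ⟩
    (toℕ a + (2 * n ∸ toℕ a) % (2 * n)) % (2 * n) ≡⟨ %-absorbʳ (toℕ a) (2 * n ∸ toℕ a) ⟩
    (toℕ a + (2 * n ∸ toℕ a)) % (2 * n)     ≡⟨ cong (_% (2 * n)) (m+[n∸m]≡n (<⇒≤ (toℕ<n a))) ⟩
    2 * n % (2 * n)                         ≡⟨ n%n≡0 (2 * n) ⟩
    0                                       ≡⟨ m<n⇒m%n≡m (>-nonZero⁻¹ (2 * n)) ⟨
    0 % (2 * n)                             ∎)
    where open ≡-Reasoning

  ⊕-isAbelianGroup : IsAbelianGroup _≡_ _⊕_ 𝟎 ⊖_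
  ⊕-isAbelianGroup = record
    { isGroup = record
      { isMonoid = record
        { isSemigroup = record { isMagma = isMagma _⊕_ ; assoc = ⊕-assoc }
        ; identity    = (λ a → trans (⊕-comm 𝟎 a) (⊕-identityʳ a)) , ⊕-identityʳ
        }
      ; inverse = (λ a → trans (⊕-comm (⊖ a) a) (⊕-inverseʳ a)) , ⊕-inverseʳ
      ; ⁻¹-cong = cong ⊖_
      }
    ; comm = ⊕-comm
    }

  ⊕-abelianGroup : AbelianGroup _ _
  ⊕-abelianGroup = record { isAbelianGroup = ⊕-isAbelianGroup }

  open AbelianGroupProperties ⊕-abelianGroup public
    using (//-rightDividesˡ; //-rightDividesʳ; quasigroup)
    renaming (⁻¹-∙-comm to ⊖-⊕-comm; ⁻¹-involutive to ⊖-involutive; ⁻¹-anti-homo‿- to ⊖-anti-homo‿-; x∙y⁻¹≈ε⇒x≈y to x-y≡𝟎⇒x≡y)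
  open QuasigroupProperties quasigroup public using () renaming (cancelˡ to ⊕-cancelˡ; cancelʳ to ⊕-cancelʳ)
  open IsAbelianGroup ⊕-isAbelianGroup public using () renaming (identityˡ to ⊕-identityˡ; inverseˡ to ⊕-inverseˡ)

  -≡⇒≡⊕ : ∀ {a b c} → a - b ≡ c → a ≡ c ⊕ b
  -≡⇒≡⊕ {a} {b} refl = sym (//-rightDividesˡ b a)

  ≡⊕⇒-≡ : ∀ {a b c} → a ≡ c ⊕ b → a - b ≡ c
  ≡⊕⇒-≡ {b = b} {c} refl = //-rightDividesʳ b c

  [a⊕t]-[b⊕t]≡a-b : ∀ a b t → (a ⊕ t) - (b ⊕ t) ≡ a - b
  [a⊕t]-[b⊕t]≡a-b a b t = ≡⊕⇒-≡ (begin
    a ⊕ t               ≡⟨ cong (_⊕ t) (-≡⇒≡⊕ {a} {b} refl) ⟩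
    a - b ⊕ b ⊕ t       ≡⟨ ⊕-assoc (a - b) b t ⟩
    a - b ⊕ (b ⊕ t)     ∎)
    where open ≡-Reasoning

  -‿cancelˡ : ∀ {a b b′} → a - b ≡ a - b′ → b ≡ b′
  -‿cancelˡ {a} {b} {b′} eq = trans (sym (⊖-involutive b)) (trans (cong ⊖_ (⊕-cancelˡ a _ _ eq)) (⊖-involutive b′))

  ν⊕ν≡𝟎 : ν ⊕ ν ≡ 𝟎
  ν⊕ν≡𝟎 = %-≡⇒mod-≡ _ _ (begin
    (toℕ ν + toℕ ν) % (2 * n) ≡⟨ cong₂ (λ u v → (u + v) % (2 * n)) toℕ-ν toℕ-ν ⟩
    (n + n) % (2 * n)         ≡⟨ cong (_% (2 * n)) 2n≡n+n ⟨
    2 * n % (2 * n)           ≡⟨ n%n≡0 (2 * n) ⟩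
    0                         ≡⟨ m<n⇒m%n≡m (>-nonZero⁻¹ (2 * n)) ⟨
    0 % (2 * n)               ∎)
    where open ≡-Reasoning

  ⊖ν≡ν : ⊖ ν ≡ ν
  ⊖ν≡ν = ⊕-cancelʳ ν _ _ (trans (⊕-inverseˡ ν) (sym ν⊕ν≡𝟎))

  a⊕ν⊕ν≡a : ∀ a → a ⊕ ν ⊕ ν ≡ a
  a⊕ν⊕ν≡a a = trans (⊕-assoc a ν ν) (trans (cong (a ⊕_) ν⊕ν≡𝟎) (⊕-identityʳ a))

  a⊕ν≢a : ∀ a → a ⊕ ν ≢ a
  a⊕ν≢a a eq = 0<n (toℕ-ν-≡0 (⊕-cancelˡ a ν 𝟎 (trans eq (sym (⊕-identityʳ a)))))
    where
    0<n : ¬ n ≡ 0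
    0<n n≡0 = <-irrefl (sym n≡0) (>-nonZero⁻¹ n)
    toℕ-ν-≡0 : ν ≡ 𝟎 → n ≡ 0
    toℕ-ν-≡0 ν≡𝟎 = trans (sym toℕ-ν) (trans (cong toℕ ν≡𝟎) toℕ-𝟎)

  a-[t⊕ν]≡a-t⊕ν : ∀ a t → a - (t ⊕ ν) ≡ a - t ⊕ ν
  a-[t⊕ν]≡a-t⊕ν a t = trans (cong (a ⊕_) (trans (sym (⊖-⊕-comm t ν)) (cong (⊖ t ⊕_) ⊖ν≡ν))) (sym (⊕-assoc a (⊖ t) ν))

  ν≡-⇒⊕ν≡ : ∀ {u v} → ν ≡ u - v → u ⊕ ν ≡ v
  ν≡-⇒⊕ν≡ {u} {v} ν≡u-v = trans (cong (_⊕ ν) (trans (-≡⇒≡⊕ (sym ν≡u-v)) (⊕-comm ν v))) (a⊕ν⊕ν≡a v)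

  ⊕ν≡⇒ν≡- : ∀ {u v} → u ⊕ ν ≡ v → ν ≡ u - v
  ⊕ν≡⇒ν≡- {u} {v} u⊕ν≡v = sym (≡⊕⇒-≡ (trans (sym (a⊕ν⊕ν≡a u)) (trans (cong (_⊕ ν) u⊕ν≡v) (⊕-comm v ν))))

  diffZ≡- : ∀ a b → diffZ n a b ≡ a - b
  diffZ≡- a b = %-≡⇒mod-≡ _ _ (trans (sym (%-absorbʳ (toℕ a) (2 * n ∸ toℕ b)))
                                      (cong (λ t → (toℕ a + t) % (2 * n)) (sym (toℕ-mod _))))

  shiftV≡⊕ν : ∀ a → shiftV n (just a) ≡ just (a ⊕ ν)
  shiftV≡⊕ν a = cong just (%-≡⇒mod-≡ _ _ (trans (sym (%-absorbʳ (toℕ a) n))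
                                                 (cong (λ t → (toℕ a + t) % (2 * n)) (sym (toℕ-mod n)))))

  ≢𝟎⇒toℕ≢0 : ∀ d → d ≢ 𝟎 → toℕ d ≢ 0
  ≢𝟎⇒toℕ≢0 d d≢𝟎 eq = d≢𝟎 (toℕ-injective (trans eq (sym toℕ-𝟎)))

  allZ : List Z
  allZ = allFin (2 * n)

  lowerHalf : List Z
  lowerHalf = filter (λ z → toℕ z <? n) allZ

  private
    toℕ-⊕ν : ∀ z → toℕ (z ⊕ ν) ≡ (toℕ z + n) % (2 * n)
    toℕ-⊕ν z = trans (toℕ-mod _) (cong (λ t → (toℕ z + t) % (2 * n)) toℕ-ν)

    ∈-lowerHalf⇒< : ∀ {z} → z ∈ lowerHalf → toℕ z < n
    ∈-lowerHalf⇒< z∈ = proj₂ (∈-filter⁻ (λ z → toℕ z <? n) {xs = allZ} z∈)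

  <⇒∈-lowerHalf : ∀ {z} → toℕ z < n → z ∈ lowerHalf
  <⇒∈-lowerHalf {z} z<n = ∈-filter⁺ (λ z → toℕ z <? n) (∈-allFin z) z<n

  lower⊕ν-upper : ∀ z → toℕ z < n → n ≤ toℕ (z ⊕ ν)
  lower⊕ν-upper z z<n = subst (n ≤_) (sym (trans (toℕ-⊕ν z) (m<n⇒m%n≡m z+n<2n))) (m≤n+m n (toℕ z))
    where
    z+n<2n : toℕ z + n < 2 * n
    z+n<2n = subst (toℕ z + n <_) (sym 2n≡n+n) (+-monoˡ-< n z<n)

  upper⊕ν-lower : ∀ z → ¬ toℕ z < n → toℕ (z ⊕ ν) < n
  upper⊕ν-lower z z≮n = subst (_< n) (sym toℕ[z⊕ν]≡z∸n) (+-cancelʳ-< _ _ n z∸n+n<n+n)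
    where
    n≤z : n ≤ toℕ z
    n≤z = ≮⇒≥ z≮n
    toℕ[z⊕ν]≡z∸n : toℕ (z ⊕ ν) ≡ toℕ z ∸ n
    toℕ[z⊕ν]≡z∸n = begin
      toℕ (z ⊕ ν)                 ≡⟨ toℕ-⊕ν z ⟩
      (toℕ z + n) % (2 * n)       ≡⟨ m≤n⇒[n∸m]%m≡n%m (subst (_≤ toℕ z + n) (sym 2n≡n+n) (+-monoˡ-≤ n n≤z)) ⟨
      (toℕ z + n ∸ 2 * n) % (2 * n) ≡⟨ cong (λ k → (toℕ z + n ∸ k) % (2 * n)) 2n≡n+n ⟩
      (toℕ z + n ∸ (n + n)) % (2 * n) ≡⟨ cong (_% (2 * n)) (trans (sym (∸-+-assoc (toℕ z + n) n n)) (cong (_∸ n) (m+n∸n≡m (toℕ z) n))) ⟩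
      (toℕ z ∸ n) % (2 * n)       ≡⟨ m<n⇒m%n≡m (≤-<-trans (m∸n≤m (toℕ z) n) (toℕ<n z)) ⟩
      toℕ z ∸ n                   ∎
      where open ≡-Reasoning
    z∸n+n<n+n : toℕ z ∸ n + n < n + n
    z∸n+n<n+n = subst₂ _<_ (sym (m∸n+n≡m n≤z)) 2n≡n+n (toℕ<n z)

  lowerHalf-++-upper↭allZ : lowerHalf ++ map (_⊕ ν) lowerHalf ↭ allZ
  lowerHalf-++-upper↭allZ = unique-⇔⇒↭ unique (Unique.allFin⁺ (2 * n)) (λ z _ → ∈-allFin z) covers
    where
    disjoint : ∀ {z} → z ∈ lowerHalf → z ∉ map (_⊕ ν) lowerHalf
    disjoint z∈ z∈upper with ∈-map⁻ (_⊕ ν) z∈upper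
    ... | w , w∈ , refl = <⇒≱ (∈-lowerHalf⇒< z∈) (lower⊕ν-upper w (∈-lowerHalf⇒< w∈))
    unique : Unique (lowerHalf ++ map (_⊕ ν) lowerHalf)
    unique = Unique.++⁺ uniqueLower (Unique.map⁺ (λ {a} {b} → ⊕-cancelʳ ν a b) uniqueLower) (λ (l , u) → disjoint l u)
      where
      uniqueLower : Unique lowerHalf
      uniqueLower = Unique.filter⁺ (λ z → toℕ z <? n) (Unique.allFin⁺ (2 * n))
    covers : ∀ z → z ∈ allZ → z ∈ lowerHalf ++ map (_⊕ ν) lowerHalf
    covers z _ with toℕ z <? n
    ... | yes z<n = ∈-++⁺ˡ (<⇒∈-lowerHalf z<n)
    ... | no z≮n  = ∈-++⁺ʳ lowerHalf (subst (_∈ map (_⊕ ν) lowerHalf) (a⊕ν⊕ν≡a z)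
                                        (∈-map⁺ (_⊕ ν) (<⇒∈-lowerHalf (upper⊕ν-lower z z≮n))))

  ∑-halves : (g : Z → ℕ) → ∑ allZ g ≡ ∑ lowerHalf g + ∑ lowerHalf (λ t → g (t ⊕ ν))
  ∑-halves g = begin
    ∑ allZ g                                              ≡⟨ ∑-↭ g lowerHalf-++-upper↭allZ ⟨
    ∑ (lowerHalf ++ map (_⊕ ν) lowerHalf) g               ≡⟨ ∑-++ lowerHalf _ g ⟩
    ∑ lowerHalf g + ∑ (map (_⊕ ν) lowerHalf) g            ≡⟨ cong (∑ lowerHalf g +_) (∑-map lowerHalf (_⊕ ν) g) ⟩
    ∑ lowerHalf g + ∑ lowerHalf (λ t → g (t ⊕ ν))         ∎
    where open ≡-Reasoning

  ∑-periodic : (g : Z → ℕ) → (∀ t → g (t ⊕ ν) ≡ g t) → ∑ allZ g ≡ ∑ lowerHalf g + ∑ lowerHalf g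
  ∑-periodic g periodic = trans (∑-halves g) (cong (∑ lowerHalf g +_) (∑-cong lowerHalf (λ t _ → periodic t)))

  ∑-lowerHalf-hits-pair : ∀ u c → ∑ lowerHalf (λ t → ind (u - t ≟ c) + ind (u - t ≟ c ⊕ ν)) ≡ 1
  ∑-lowerHalf-hits-pair u c = begin
    ∑ lowerHalf (λ t → ind (u - t ≟ c) + ind (u - t ≟ c ⊕ ν))  ≡⟨ ∑-+ lowerHalf _ _ ⟩
    ∑ lowerHalf hit + ∑ lowerHalf (λ t → ind (u - t ≟ c ⊕ ν))   ≡⟨ cong (∑ lowerHalf hit +_) (∑-cong lowerHalf (λ t _ → upper t)) ⟩
    ∑ lowerHalf hit + ∑ lowerHalf (λ t → hit (t ⊕ ν))            ≡⟨ ∑-halves hit ⟨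
    ∑ allZ hit                                                    ≡⟨ ∑-ind-at-most-one _≟_ allZ (λ t → u - t ≟ c) (u - c) (yes tt)
                                                                      (Unique.allFin⁺ (2 * n)) (∈-allFin _) only at ⟩
    1                                                             ∎
    where
    open ≡-Reasoning
    hit : Z → ℕ
    hit t = ind (u - t ≟ c)
    upper : ∀ t → ind (u - t ≟ c ⊕ ν) ≡ hit (t ⊕ ν)
    upper t = ind-cong (u - t ≟ c ⊕ ν) (u - (t ⊕ ν) ≟ c)
      (λ eq → trans (a-[t⊕ν]≡a-t⊕ν u t) (trans (cong (_⊕ ν) eq) (a⊕ν⊕ν≡a c)))
      (λ eq → trans (sym (a⊕ν⊕ν≡a _)) (cong (_⊕ ν) (trans (sym (a-[t⊕ν]≡a-t⊕ν u t)) eq)))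
    only : ∀ t → u - t ≡ c → t ≡ u - c × ⊤
    only t u-t≡c = sym (≡⊕⇒-≡ (trans (-≡⇒≡⊕ u-t≡c) (⊕-comm c t))) , tt
    at : ⊤ → u - (u - c) ≡ c
    at _ = ≡⊕⇒-≡ (trans (-≡⇒≡⊕ {u} {c} refl) (⊕-comm (u - c) c))

  open EdgeCount (_≟_ {2 * n})

  diff : Z × Z → Z
  diff e = proj₁ e - proj₂ e

  diffCount : List (Z × Z) → Z → ℕ
  diffCount L d = ∑ L (λ e → ind (diff e ≟ d))

  ∑-diffCount : (L : List (Z × Z)) → ∑ allZ (diffCount L) ≡ length L
  ∑-diffCount L = begin
    ∑ allZ (diffCount L)                                  ≡⟨ ∑-swap allZ L _ ⟩
    ∑ L (λ e → ∑ allZ (λ d → ind (diff e ≟ d)))          ≡⟨ ∑-cong L (λ e _ → once e) ⟩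
    ∑ L (λ _ → 1)                                         ≡⟨ ∑-const L 1 ⟩
    1 * length L                                          ≡⟨ *-identityˡ (length L) ⟩
    length L                                              ∎
    where
    open ≡-Reasoning
    once : ∀ e → ∑ allZ (λ d → ind (diff e ≟ d)) ≡ 1
    once e = trans (∑-cong allZ (λ d _ → ind-cong (diff e ≟ d) (d ≟ diff e) sym sym))
                   (∑-ind-≟ _≟_ allZ (Unique.allFin⁺ (2 * n)) (∈-allFin (diff e)))

  ∑-diffCount-⊖ : (L : List (Z × Z)) → ∑ allZ (λ d → diffCount L (⊖ d)) ≡ length L
  ∑-diffCount-⊖ L = begin
    ∑ allZ (λ d → diffCount L (⊖ d))   ≡⟨ ∑-map allZ ⊖_ (diffCount L) ⟨
    ∑ (map ⊖_ allZ) (diffCount L)      ≡⟨ ∑-↭ (diffCount L) (map-inverse-allFin-↭ ⊖_ ⊖_ ⊖-involutive ⊖-involutive) ⟩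
    ∑ allZ (diffCount L)               ≡⟨ ∑-diffCount L ⟩
    length L                           ∎
    where open ≡-Reasoning

  private
    ∑-translates-edge : ∀ c c′ x y →
      ∑ allZ (λ t → ind ((c ≟ x - t) ×-dec (c′ ≟ y - t))) ≡ ind (c - c′ ≟ x - y)
    ∑-translates-edge c c′ x y =
      ∑-ind-at-most-one _≟_ allZ _ (x - c) (c - c′ ≟ x - y) (Unique.allFin⁺ (2 * n)) (∈-allFin _) only at
      where
      x-[x-c]≡c : x - (x - c) ≡ c
      x-[x-c]≡c = ≡⊕⇒-≡ (trans (-≡⇒≡⊕ {x} {c} refl) (⊕-comm (x - c) c))
      only : ∀ t → c ≡ x - t × c′ ≡ y - t → t ≡ x - c × c - c′ ≡ x - y
      only t (refl , refl) = sym (≡⊕⇒-≡ (trans (-≡⇒≡⊕ {x} {t} refl) (⊕-comm _ t))) , [a⊕t]-[b⊕t]≡a-b x y (⊖ t)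
      at : c - c′ ≡ x - y → c ≡ x - (x - c) × c′ ≡ y - (x - c)
      at eq = sym x-[x-c]≡c , -‿cancelˡ (begin
        c - c′                      ≡⟨ eq ⟩
        x - y                       ≡⟨ [a⊕t]-[b⊕t]≡a-b x y (⊖ (x - c)) ⟨
        (x - (x - c)) - (y - (x - c)) ≡⟨ cong (_- (y - (x - c))) x-[x-c]≡c ⟩
        c - (y - (x - c))           ∎)
        where open ≡-Reasoning

  ∑-translates-edgeCount : (L : List (Z × Z)) (x y : Z) → x ≢ y →
    ∑ allZ (λ t → edgeCount L (x - t) (y - t)) ≡ diffCount L (x - y) + diffCount L (y - x)
  ∑-translates-edgeCount L x y x≢y =
    trans (∑-swap allZ L _) (trans (∑-cong L (λ { (c , c′) _ → perEdge c c′ })) (∑-+ L _ _))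
    where
    perEdge : ∀ c c′ → ∑ allZ (λ t → ind (joins? (x - t) (y - t) (c , c′))) ≡ ind (c - c′ ≟ x - y) + ind (c - c′ ≟ y - x)
    perEdge c c′ = begin
      ∑ allZ (λ t → ind (joins? (x - t) (y - t) (c , c′)))
        ≡⟨ ∑-cong allZ (λ t _ → ind-⊎ ((c ≟ x - t) ×-dec (c′ ≟ y - t)) ((c ≟ y - t) ×-dec (c′ ≟ x - t))
                                      (λ (c≡x-t , _) (c≡y-t , _) → x≢y (⊕-cancelʳ (⊖ t) x y (trans (sym c≡x-t) c≡y-t)))) ⟩
      ∑ allZ (λ t → ind ((c ≟ x - t) ×-dec (c′ ≟ y - t)) + ind ((c ≟ y - t) ×-dec (c′ ≟ x - t)))
        ≡⟨ ∑-+ allZ _ _ ⟩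
      ∑ allZ (λ t → ind ((c ≟ x - t) ×-dec (c′ ≟ y - t))) + ∑ allZ (λ t → ind ((c ≟ y - t) ×-dec (c′ ≟ x - t)))
        ≡⟨ cong₂ _+_ (∑-translates-edge c c′ x y) (∑-translates-edge c c′ y x) ⟩
      ind (c - c′ ≟ x - y) + ind (c - c′ ≟ y - x) ∎
      where open ≡-Reasoning

  private
    double-injective : ∀ j k → j + j ≡ k + k → j ≡ k
    double-injective zero    zero    _  = refl
    double-injective (suc j) (suc k) eq =
      cong suc (double-injective j k (suc-injective (trans (sym (+-suc j j)) (trans (suc-injective eq) (+-suc k k)))))

  -- For a ν-invariant edge list the translates by t and t ⊕ ν agree, so the lower half of ℤ₂ₙ sees half of each count.
  ∑-lowerHalf-translates : (L : List (Z × Z)) → (∀ u v → edgeCount L (u ⊕ ν) (v ⊕ ν) ≡ edgeCount L u v) →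
    (x y : Z) → x ≢ y → (k : ℕ) → diffCount L (x - y) + diffCount L (⊖ (x - y)) ≡ k + k →
    ∑ lowerHalf (λ t → edgeCount L (x - t) (y - t)) ≡ k
  ∑-lowerHalf-translates L invariant x y x≢y k counts = double-injective _ k (begin
    ∑ lowerHalf h + ∑ lowerHalf h                    ≡⟨ ∑-periodic h periodic ⟨
    ∑ allZ h                                         ≡⟨ ∑-translates-edgeCount L x y x≢y ⟩
    diffCount L (x - y) + diffCount L (y - x)        ≡⟨ cong (λ d → diffCount L (x - y) + diffCount L d) (⊖-anti-homo‿- x y) ⟨
    diffCount L (x - y) + diffCount L (⊖ (x - y))    ≡⟨ counts ⟩
    k + k                                            ∎)
    where
    open ≡-Reasoning
    h : Z → ℕ
    h t = edgeCount L (x - t) (y - t)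
    periodic : ∀ t → h (t ⊕ ν) ≡ h t
    periodic t = trans (cong₂ (edgeCount L) (a-[t⊕ν]≡a-t⊕ν x t) (a-[t⊕ν]≡a-t⊕ν y t)) (invariant _ _)

  ind-ν≟⊖ : ∀ d → ind (ν ≟ ⊖ d) ≡ ind (ν ≟ d)
  ind-ν≟⊖ d = ind-cong (ν ≟ ⊖ d) (ν ≟ d) (λ ν≡⊖d → trans (sym ⊖ν≡ν) (trans (cong ⊖_ ν≡⊖d) (⊖-involutive d)))
                                           (λ ν≡d → trans (sym ⊖ν≡ν) (cong ⊖_ ν≡d))

  antipodal-edge-invariant : ∀ u v c d → d ≡ c ⊕ ν → ind (joins? (u ⊕ ν) (v ⊕ ν) (c , d)) ≡ ind (joins? u v (c , d))
  antipodal-edge-invariant u v c d refl = ind-cong (joins? (u ⊕ ν) (v ⊕ ν) (c , c ⊕ ν)) (joins? u v (c , c ⊕ ν)) to from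
    where
    to : Joins (u ⊕ ν) (v ⊕ ν) (c , c ⊕ ν) → Joins u v (c , c ⊕ ν)
    to (inj₁ (refl , c⊕ν≡v⊕ν)) = inj₂ (⊕-cancelʳ ν _ _ c⊕ν≡v⊕ν , a⊕ν⊕ν≡a u)
    to (inj₂ (refl , c⊕ν≡u⊕ν)) = inj₁ (⊕-cancelʳ ν _ _ c⊕ν≡u⊕ν , a⊕ν⊕ν≡a v)
    from : Joins u v (c , c ⊕ ν) → Joins (u ⊕ ν) (v ⊕ ν) (c , c ⊕ ν)
    from (inj₁ (refl , refl)) = inj₂ (sym (a⊕ν⊕ν≡a c) , refl)
    from (inj₂ (refl , refl)) = inj₁ (sym (a⊕ν⊕ν≡a c) , refl)

module StarterStructure (n : ℕ) .{{_ : NonZero n}} {ℓ∞ : ℕ} {ℓs : List ℕ} (st : Starter n ℓ∞ ℓs) where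
  open Cyclic n
  open Starter st

  -- Σ read as the cycle ∞ a ⋯ b through ∞ together with cycles on ℤ₂ₙ only.
  record Decomposition : Set where
    field
      a              : Z
      path           : List Z
      cycles         : List (List Z)
      path≢[]        : path ≢ []
      length-path    : suc (suc (length path)) ≡ ℓ∞
      vertices       : (a ∷ path) ++ concat cycles ↭ allZ
      cycles-long    : All (λ c → 3 ≤ length c) cycles
      cycles-lengths : map length cycles ↭ ℓs
      edges↭         : edges (cyc∞ ∷ cycs) ↭
                       (nothing , just a) ∷ (just (pathEnd a path) , nothing) ∷ map (both just) (pathEdges a path ++ edges cycles)

  private
    module SplitAt∞ (p q : List (Vtx n)) (cyc∞≡ : cyc∞ ≡ p ++ nothing ∷ q) where
      finite↭ : q ++ p ++ concat cycs ↭ map just allZ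
      finite↭ = ↭-trans (Perm.shifts q p) (Perm.drop-∷ (begin
        nothing ∷ p ++ q ++ concat cycs    ↭⟨ Perm.shift nothing p (q ++ concat cycs) ⟨
        p ++ nothing ∷ q ++ concat cycs    ≡⟨ List.++-assoc p (nothing ∷ q) (concat cycs) ⟨
        (p ++ nothing ∷ q) ++ concat cycs  ≡⟨ cong (_++ concat cycs) cyc∞≡ ⟨
        concat (cyc∞ ∷ cycs)               ↭⟨ proj₁ twoReg ⟩
        nothing ∷ map just allZ            ∎))
        where open PermutationReasoning

      finite : ∀ v → v ∈ q ++ p ++ concat cycs → ∃[ x ] (v ≡ just x)
      finite v v∈ with x , _ , v≡ ← ∈-map⁻ just (Perm.∈-resp-↭ finite↭ v∈) = x , v≡

      finite-path : ∃[ w ] (q ++ p ≡ map just w)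
      finite-path = map-just-view (q ++ p) (λ v v∈ → finite v (subst (v ∈_) (List.++-assoc q p (concat cycs)) (∈-++⁺ˡ v∈)))

      w : List Z
      w = proj₁ finite-path

      finite-cycles : ∃[ cs ] (cycs ≡ map (map just) cs)
      finite-cycles = map-map-just-view cycs (λ v v∈ → finite v (∈-++⁺ʳ q (∈-++⁺ʳ p v∈)))

      cs : List (List Z)
      cs = proj₁ finite-cycles

      cycs≡ : cycs ≡ map (map just) cs
      cycs≡ = proj₂ finite-cycles

      finite≡ : q ++ p ++ concat cycs ≡ map just (w ++ concat cs)
      finite≡ = begin
        q ++ p ++ concat cycs                 ≡⟨ List.++-assoc q p _ ⟨
        (q ++ p) ++ concat cycs               ≡⟨ cong₂ _++_ (proj₂ finite-path) (trans (cong concat cycs≡) (List.concat-map cs)) ⟩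
        map just w ++ map just (concat cs)    ≡⟨ List.map-++ just w (concat cs) ⟨
        map just (w ++ concat cs)             ∎
        where open ≡-Reasoning

      vertices-w : w ++ concat cs ↭ allZ
      vertices-w with ys , finite≡ys , allZ↭ys ← Perm.↭-map-inv just (↭-sym finite↭) =
        ↭-sym (subst (allZ ↭_) (List.map-injective just-injective (trans (sym finite≡ys) finite≡)) allZ↭ys)

      length-cyc∞ : length cyc∞ ≡ suc (length w)
      length-cyc∞ = begin
        length cyc∞                  ≡⟨ cong length cyc∞≡ ⟩
        length (p ++ nothing ∷ q)    ≡⟨ List.length-++ p ⟩
        length p + suc (length q)    ≡⟨ +-suc (length p) (length q) ⟩
        suc (length p + length q)    ≡⟨ cong suc (+-comm (length p) (length q)) ⟩
        suc (length q + length p)    ≡⟨ cong suc (List.length-++ q) ⟨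
        suc (length (q ++ p))        ≡⟨ cong (λ l → suc (length l)) (proj₂ finite-path) ⟩
        suc (length (map just w))    ≡⟨ cong suc (List.length-map just w) ⟩
        suc (length w)               ∎
        where open ≡-Reasoning

      edges-cyc∞ : cycleEdges cyc∞ ↭ cycleEdges (nothing ∷ map just w)
      edges-cyc∞ = subst (λ c → cycleEdges c ↭ cycleEdges (nothing ∷ map just w)) (sym cyc∞≡)
        (↭-trans (cycleEdges-rotate p (nothing ∷ q)) (↭-reflexive (cong (λ l → cycleEdges (nothing ∷ l)) (proj₂ finite-path))))

      long∞ : 3 ≤ length cyc∞
      long∞ = All.head (proj₂ twoReg)

      lengths-cs : map length cs ↭ ℓs
      lengths-cs = subst (_↭ ℓs) lengths≡ lens
        where
        lengths≡ : map length cycs ≡ map length cs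
        lengths≡ = trans (cong (map length) cycs≡)
                         (trans (sym (List.map-∘ cs)) (List.map-cong (List.length-map just) cs))

      cs-long : All (λ c → 3 ≤ length c) cs
      cs-long = All.map (λ {c} long → subst (3 ≤_) (List.length-map just c) long)
                  (All.map⁻ (subst (All (λ c → 3 ≤ length c)) cycs≡ (All.tail (proj₂ twoReg))))

      assemble : (w : List Z) → w ++ concat cs ↭ allZ → length cyc∞ ≡ suc (length w) →
        cycleEdges cyc∞ ↭ cycleEdges (nothing ∷ map just w) → Decomposition
      assemble []           _ len _ with s≤s () ← subst (3 ≤_) len long∞
      assemble (_ ∷ [])     _ len _ with s≤s (s≤s ()) ← subst (3 ≤_) len long∞
      assemble (a ∷ b ∷ w′) vs len es = record
        { a = a ; path = path ; cycles = cs ; path≢[] = λ ()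
        ; length-path = trans (sym len) len∞
        ; vertices = vs ; cycles-long = cs-long ; cycles-lengths = lengths-cs
        ; edges↭ = edges↭ }
        where
        path : List Z
        path = b ∷ w′
        X Y : List (Vtx n × Vtx n)
        X = map (both just) (pathEdges a path)
        Y = map (both just) (edges cs)
        e∞ : Vtx n × Vtx n
        e∞ = (just (pathEnd a path) , nothing)

        cycle∞≡ : cycleEdges (nothing ∷ map just (a ∷ path)) ≡ (nothing , just a) ∷ X ++ [ e∞ ]
        cycle∞≡ = trans (cycleEdges-∷ nothing (map just (a ∷ path)))
          (cong₂ (λ P e → (nothing , just a) ∷ P ++ [ (e , nothing) ]) (pathEdges-map just a path) (pathEnd-map just a path))

        edges↭ : edges (cyc∞ ∷ cycs) ↭ (nothing , just a) ∷ e∞ ∷ map (both just) (pathEdges a path ++ edges cs)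
        edges↭ = begin
          cycleEdges cyc∞ ++ edges cycs                             ↭⟨ Perm.++⁺ʳ (edges cycs) es ⟩
          cycleEdges (nothing ∷ map just (a ∷ path)) ++ edges cycs  ≡⟨ cong₂ _++_ cycle∞≡ (trans (cong edges cycs≡) (edges-map just cs)) ⟩
          (nothing , just a) ∷ (X ++ [ e∞ ]) ++ Y                   ≡⟨ cong ((nothing , just a) ∷_) (List.++-assoc X [ e∞ ] Y) ⟩
          (nothing , just a) ∷ X ++ e∞ ∷ Y                          ↭⟨ prep _ (Perm.shift e∞ X Y) ⟩
          (nothing , just a) ∷ e∞ ∷ X ++ Y                          ≡⟨ cong (λ l → (nothing , just a) ∷ e∞ ∷ l)
                                                                         (List.map-++ (both just) (pathEdges a path) (edges cs)) ⟨
          (nothing , just a) ∷ e∞ ∷ map (both just) (pathEdges a path ++ edges cs) ∎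
          where open PermutationReasoning

      result : Decomposition
      result = assemble w vertices-w length-cyc∞ edges-cyc∞

  opaque
    decomposition : Decomposition
    decomposition with p , q , cyc∞≡ ← ∈-∃++ ∞∈cyc∞ = SplitAt∞.result p q cyc∞≡

  open Decomposition decomposition public

  b : Z
  b = pathEnd a path

  finiteEdges : List (Z × Z)
  finiteEdges = pathEdges a path ++ edges cycles

  private
    module Vertex = EdgeCount (_≟ᵛ_ n)
    module Finite = EdgeCount (_≟_ {2 * n})
    open Finite using (edgeCount)

    multΣ : Vtx n → Vtx n → ℕ
    multΣ = mult (_≟ᵛ_ n) (cyc∞ ∷ cycs)

    Σedges : List (Vtx n × Vtx n)
    Σedges = (nothing , just a) ∷ (just b , nothing) ∷ map (both just) finiteEdges

    multΣ≡ : ∀ u v → multΣ u v ≡ Vertex.edgeCount Σedges u v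
    multΣ≡ u v = trans (Vertex.mult≡edgeCount (cyc∞ ∷ cycs) u v) (Vertex.edgeCount-↭ u v edges↭)

  multΣ-finite : ∀ x y → mult (_≟ᵛ_ n) (cyc∞ ∷ cycs) (just x) (just y) ≡ edgeCount finiteEdges x y
  multΣ-finite x y = trans (multΣ≡ (just x) (just y))
    (cong₂ _+_ (ind-no (Vertex.joins? (just x) (just y) (nothing , just a)) (λ { (inj₁ (() , _)) ; (inj₂ (() , _)) }))
      (cong₂ _+_ (ind-no (Vertex.joins? (just x) (just y) (just b , nothing)) (λ { (inj₁ (_ , ())) ; (inj₂ (_ , ())) }))
        (EdgeCountMap.edgeCount-map-injective (_≟_ {2 * n}) (_≟ᵛ_ n) just just-injective finiteEdges x y)))

  finiteEdges-invariant : ∀ x y → edgeCount finiteEdges (x ⊕ ν) (y ⊕ ν) ≡ edgeCount finiteEdges x y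
  finiteEdges-invariant x y = begin
    edgeCount finiteEdges (x ⊕ ν) (y ⊕ ν)          ≡⟨ multΣ-finite (x ⊕ ν) (y ⊕ ν) ⟨
    multΣ (just (x ⊕ ν)) (just (y ⊕ ν))            ≡⟨ cong₂ multΣ (shiftV≡⊕ν x) (shiftV≡⊕ν y) ⟨
    multΣ (shiftV n (just x)) (shiftV n (just y))  ≡⟨ invariant (just x) (just y) ⟩
    multΣ (just x) (just y)                        ≡⟨ multΣ-finite x y ⟩
    edgeCount finiteEdges x y                      ∎
    where open ≡-Reasoning

  private
    ∞-neighbour : ∀ y → 1 ≤ multΣ nothing (just y) → y ≡ a ⊎ y ≡ b
    ∞-neighbour y ∞~y = Sum.map just-injective just-injective
      (Vertex.neighbours-of-apex nothing (just a) (just b) (just y) (map (both just) finiteEdges)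
         finite-edge (subst (1 ≤_) (multΣ≡ nothing (just y)) ∞~y))
      where
      finite-edge : ∀ e → e ∈ map (both just) finiteEdges → proj₁ e ≢ nothing × proj₂ e ≢ nothing
      finite-edge e e∈ with _ , _ , refl ← ∈-map⁻ (both just) e∈ = (λ ()) , (λ ())

    ∞~a⊕ν : 1 ≤ multΣ nothing (just (a ⊕ ν))
    ∞~a⊕ν = subst (1 ≤_) (trans (sym (invariant nothing (just a))) (cong (multΣ nothing) (shiftV≡⊕ν a)))
                         (subst (1 ≤_) (sym (multΣ≡ nothing (just a))) (Vertex.∈⇒edgeCount-pos Σedges nothing (just a) (here refl)))

  b≡a⊕ν : b ≡ a ⊕ ν
  b≡a⊕ν = [ (λ a⊕ν≡a → ⊥-elim (a⊕ν≢a a a⊕ν≡a)) , sym ]′ (∞-neighbour (a ⊕ ν) ∞~a⊕ν)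

  unique-vertices : Unique ((a ∷ path) ++ concat cycles)
  unique-vertices = Unique-resp-↭ (↭-sym vertices) (Unique.allFin⁺ (2 * n))

  unique-path : Unique (a ∷ path)
  unique-path = Unique-++⁻ˡ (a ∷ path) unique-vertices

  finiteEdges-irrefl : ∀ {u v} → (u , v) ∈ finiteEdges → u ≢ v
  finiteEdges-irrefl e∈ with ∈-++⁻ (pathEdges a path) e∈
  ... | inj₁ e∈path   = pathEdges-irrefl a path unique-path e∈path
  ... | inj₂ e∈cycles = edges-irrefl cycles (Unique-++⁻ʳ (a ∷ path) unique-vertices)
                          (All.map (≤-trans (n≤1+n 2)) cycles-long) e∈cycles

  length-finiteEdges : suc (length finiteEdges) ≡ 2 * n
  length-finiteEdges = begin
    suc (length (pathEdges a path ++ edges cycles))           ≡⟨ cong suc (List.length-++ (pathEdges a path)) ⟩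
    suc (length (pathEdges a path) + length (edges cycles))   ≡⟨ cong suc (cong₂ _+_ (length-pathEdges a path) (length-edges cycles)) ⟩
    suc (length path + length (concat cycles))                ≡⟨ cong suc (List.length-++ path) ⟨
    length ((a ∷ path) ++ concat cycles)                      ≡⟨ Perm.↭-length vertices ⟩
    length allZ                                               ≡⟨ List.length-tabulate (λ i → i) ⟩
    2 * n                                                     ∎
    where open ≡-Reasoning

  path-edge : ∀ u v → u ∈ a ∷ path → 1 ≤ edgeCount finiteEdges u v → Any (Joins u v) (pathEdges a path)
  path-edge u v u∈ u~v with e , e∈ , joins ← Finite.edgeCount-positive finiteEdges u v u~v
                       with ∈-++⁻ (pathEdges a path) e∈
  ... | inj₁ e∈path   = lose e∈path joins
  ... | inj₂ e∈cycles with c∈ , d∈ ← ∈-edges⇒∈ cycles e∈cycles | joins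
  ...   | inj₁ (refl , _) = ⊥-elim (Unique-++⇒disjoint (a ∷ path) unique-vertices u∈ c∈)
  ...   | inj₂ (_ , refl) = ⊥-elim (Unique-++⇒disjoint (a ∷ path) unique-vertices u∈ d∈)

  private
    reflected : ∃[ r ] (reverse (map (_⊕ ν) (a ∷ path)) ≡ a ∷ r × length r ≡ length path)
    reflected with r , rev≡ , length-r ← reverse-∷ (a ⊕ ν) (map (_⊕ ν) path) =
      r , trans rev≡ (cong (_∷ r) (trans (pathEnd-map (_⊕ ν) a path) b⊕ν≡a)) , trans length-r (List.length-map (_⊕ ν) path)
      where
      b⊕ν≡a : b ⊕ ν ≡ a
      b⊕ν≡a = trans (cong (_⊕ ν) b≡a⊕ν) (a⊕ν⊕ν≡a a)

  -- Reversing and translating by ν maps the path a ⋯ b onto a path from a using only edges of Σ, hence onto itself.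
  path-antisymmetric : a ∷ path ≡ reverse (map (_⊕ ν) (a ∷ path))
  path-antisymmetric = trans (cong (a ∷_) (sym (walk-along-path a path r unique-path unique-r length-r step))) (sym rev≡)
    where
    r = proj₁ reflected
    rev≡ = proj₁ (proj₂ reflected)
    length-r = proj₂ (proj₂ reflected)
    unique-r : Unique (a ∷ r)
    unique-r = subst Unique rev≡ (Unique-resp-↭ (↭-sym (Perm.↭-reverse _))
                                   (Unique.map⁺ (λ {x} {y} → ⊕-cancelʳ ν x y) unique-path))
    translated-edge : ∀ {v u} → (v , u) ∈ map (both (_⊕ ν)) (pathEdges a path) → 1 ≤ edgeCount finiteEdges v u
    translated-edge vu∈ with (p , q) , pq∈ , refl ← ∈-map⁻ (both (_⊕ ν)) vu∈ =
      subst (1 ≤_) (sym (finiteEdges-invariant p q)) (Finite.∈⇒edgeCount-pos finiteEdges p q (∈-++⁺ˡ pq∈))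
    step : ∀ u v → (u , v) ∈ pathEdges a r → u ∈ a ∷ path → Any (Joins u v) (pathEdges a path)
    step u v e∈ u∈ = path-edge u v u∈ (subst (1 ≤_) (Finite.edgeCount-sym finiteEdges v u) (translated-edge
      (subst ((v , u) ∈_) (pathEdges-map (_⊕ ν) a path) (∈-pathEdges-reverse (a ⊕ ν) (map (_⊕ ν) path) a r rev≡ e∈))))

  antipodal-step : ∃[ R ] ∃[ Q ] ∃[ x ] (path ≡ R ++ x ⊕ ν ∷ Q × pathEnd a R ≡ x)
  antipodal-step = split (reverse-map-adjacent (_⊕ ν) a⊕ν≢a (a ∷ path) (λ ()) path-antisymmetric)
    where
    split : ∃[ P ] ∃[ Q ] ∃[ x ] (a ∷ path ≡ P ++ x ∷ x ⊕ ν ∷ Q) →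
            ∃[ R ] ∃[ Q ] ∃[ x ] (path ≡ R ++ x ⊕ ν ∷ Q × pathEnd a R ≡ x)
    split ([]     , Q , x , a∷path≡) with refl , path≡ ← List.∷-injective a∷path≡ = [] , Q , x , path≡ , refl
    split (p ∷ P , Q , x , a∷path≡) with refl , path≡ ← List.∷-injective a∷path≡ =
      P ++ [ x ] , Q , x , trans path≡ (sym (List.++-assoc P [ x ] (x ⊕ ν ∷ Q))) , pathEnd-++ a P [ x ]

  private
    open Finite using (joins?)

    spread : Z → ℕ
    spread d = diffCount finiteEdges d + diffCount finiteEdges (⊖ d)

    -- An edge {x , y} of difference ±d and its translate {x + n , y + n} are two distinct edges.
    two≤spread : ∀ d → d ≢ 𝟎 → 2 ≤ spread d
    two≤spread d d≢𝟎 with x , y , x~y , diffZ≡d ← differences d (≢𝟎⇒toℕ≢0 d d≢𝟎) = begin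
      2                                                               ≤⟨ +-mono-≤ x~y′ (subst (1 ≤_) (sym (finiteEdges-invariant x y)) x~y′) ⟩
      edgeCount finiteEdges x y + edgeCount finiteEdges (x ⊕ ν) (y ⊕ ν)  ≡⟨ ∑-+ finiteEdges _ _ ⟨
      ∑ finiteEdges (λ e → ind (joins? x y e) + ind (joins? (x ⊕ ν) (y ⊕ ν) e)) ≤⟨ ∑-mono finiteEdges per-edge ⟩
      ∑ finiteEdges (λ e → ind (diff e ≟ d) + ind (diff e ≟ ⊖ d))  ≡⟨ ∑-+ finiteEdges _ _ ⟩
      spread d                                                        ∎
      where
      open ≤-Reasoning
      x~y′ : 1 ≤ edgeCount finiteEdges x y
      x~y′ = subst (1 ≤_) (multΣ-finite x y) x~y
      x-y≡d : x - y ≡ d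
      x-y≡d = trans (sym (diffZ≡- x y)) diffZ≡d
      y-x≡⊖d : y - x ≡ ⊖ d
      y-x≡⊖d = trans (sym (⊖-anti-homo‿- x y)) (cong ⊖_ x-y≡d)
      ±d : ∀ {c c′} t → Joins (x ⊕ t) (y ⊕ t) (c , c′) → c - c′ ≡ d ⊎ c - c′ ≡ ⊖ d
      ±d t (inj₁ (refl , refl)) = inj₁ (trans ([a⊕t]-[b⊕t]≡a-b x y t) x-y≡d)
      ±d t (inj₂ (refl , refl)) = inj₂ (trans ([a⊕t]-[b⊕t]≡a-b y x t) y-x≡⊖d)
      per-edge : ∀ e → e ∈ finiteEdges →
        ind (joins? x y e) + ind (joins? (x ⊕ ν) (y ⊕ ν) e) ≤ ind (diff e ≟ d) + ind (diff e ≟ ⊖ d)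
      per-edge (c , c′) _ = ind-+-mono (joins? x y (c , c′)) (joins? (x ⊕ ν) (y ⊕ ν) (c , c′))
        (diff (c , c′) ≟ d) (diff (c , c′) ≟ ⊖ d)
        (λ j → ±d 𝟎 (subst₂ (λ u v → Joins u v (c , c′)) (sym (⊕-identityʳ x)) (sym (⊕-identityʳ y)) j))
        (±d ν) both-ways
        where
        both-ways : Joins x y (c , c′) → Joins (x ⊕ ν) (y ⊕ ν) (c , c′) → c - c′ ≡ d × c - c′ ≡ ⊖ d
        both-ways (inj₁ (refl , refl)) (inj₁ (x≡x⊕ν , _))      = ⊥-elim (a⊕ν≢a x (sym x≡x⊕ν))
        both-ways (inj₁ (refl , refl)) (inj₂ (x≡y⊕ν , y≡x⊕ν)) = x-y≡d , trans (cong₂ _-_ x≡y⊕ν y≡x⊕ν) (trans ([a⊕t]-[b⊕t]≡a-b y x ν) y-x≡⊖d)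
        both-ways (inj₂ (refl , refl)) (inj₁ (y≡x⊕ν , x≡y⊕ν)) = trans (cong₂ _-_ y≡x⊕ν x≡y⊕ν) (trans ([a⊕t]-[b⊕t]≡a-b x y ν) x-y≡d) , y-x≡⊖d
        both-ways (inj₂ (refl , refl)) (inj₂ (y≡y⊕ν , _))      = ⊥-elim (a⊕ν≢a y (sym y≡y⊕ν))

    twoIfNonzero : Z → ℕ
    twoIfNonzero d with d ≟ 𝟎
    ... | yes _ = 0
    ... | no _  = 2

    twoIfNonzero≤spread : ∀ d → d ∈ allZ → twoIfNonzero d ≤ spread d
    twoIfNonzero≤spread d _ with d ≟ 𝟎
    ... | yes _   = z≤n
    ... | no d≢𝟎 = two≤spread d d≢𝟎

    ∑-spread : ∑ allZ spread + 2 ≡ 2 * (2 * n)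
    ∑-spread = begin
      ∑ allZ spread + 2                                                       ≡⟨ cong (_+ 2) (∑-+ allZ _ _) ⟩
      ∑ allZ (diffCount finiteEdges) + ∑ allZ (λ d → diffCount finiteEdges (⊖ d)) + 2
                                                                              ≡⟨ cong (_+ 2) (cong₂ _+_ (∑-diffCount finiteEdges) (∑-diffCount-⊖ finiteEdges)) ⟩
      length finiteEdges + length finiteEdges + 2                             ≡⟨ solve 1 (λ k → k :+ k :+ con 2 := con 2 :* (con 1 :+ k)) refl (length finiteEdges) ⟩
      2 * suc (length finiteEdges)                                            ≡⟨ cong (2 *_) length-finiteEdges ⟩
      2 * (2 * n)                                                             ∎
      where open ≡-Reasoning

    ∑-twoIfNonzero : ∑ allZ twoIfNonzero + 2 ≡ 2 * (2 * n)
    ∑-twoIfNonzero = begin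
      ∑ allZ twoIfNonzero + 2                                           ≡⟨ cong (λ k → ∑ allZ twoIfNonzero + 2 * k) 𝟎-once ⟨
      ∑ allZ twoIfNonzero + 2 * ∑ allZ (λ d → ind (d ≟ 𝟎))              ≡⟨ cong (∑ allZ twoIfNonzero +_) (∑-* allZ 2 _) ⟨
      ∑ allZ twoIfNonzero + ∑ allZ (λ d → 2 * ind (d ≟ 𝟎))              ≡⟨ ∑-+ allZ _ _ ⟨
      ∑ allZ (λ d → twoIfNonzero d + 2 * ind (d ≟ 𝟎))                   ≡⟨ ∑-cong allZ (λ d _ → two d) ⟩
      ∑ allZ (λ _ → 2)                                                  ≡⟨ ∑-const allZ 2 ⟩
      2 * length allZ                                                   ≡⟨ cong (2 *_) (List.length-tabulate {n = 2 * n} (λ i → i)) ⟩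
      2 * (2 * n)                                                       ∎
      where
      open ≡-Reasoning
      𝟎-once : ∑ allZ (λ d → ind (d ≟ 𝟎)) ≡ 1
      𝟎-once = ∑-ind-≟ _≟_ allZ (Unique.allFin⁺ (2 * n)) (∈-allFin 𝟎)
      two : ∀ d → twoIfNonzero d + 2 * ind (d ≟ 𝟎) ≡ 2
      two d with d ≟ 𝟎
      ... | yes _ = refl
      ... | no _  = refl

  -- Every nonzero ±d occurs at least twice among the 2n − 1 finite edges, hence exactly twice.
  finite-diffCount-± : ∀ d → d ≢ 𝟎 → diffCount finiteEdges d + diffCount finiteEdges (⊖ d) ≡ 2
  finite-diffCount-± d d≢𝟎 = trans (∑-tight allZ spread twoIfNonzero twoIfNonzero≤spread
                               (+-cancelʳ-≡ 2 _ _ (trans ∑-spread (sym ∑-twoIfNonzero))) d (∈-allFin d))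
                            twoIfNonzero-d
    where
    twoIfNonzero-d : twoIfNonzero d ≡ 2
    twoIfNonzero-d with d ≟ 𝟎
    ... | yes d≡𝟎 = ⊥-elim (d≢𝟎 d≡𝟎)
    ... | no _    = refl

-- The translates of a base 2-factor under an action of ℤ₂ₙ on Fin m, by the elements of the lower half of ℤ₂ₙ.
module Development (n : ℕ) .{{_ : NonZero n}} {m : ℕ} (act : Cyclic.Z n → Fin m → Fin m)
  (act-∘ : ∀ s t X → act s (act t X) ≡ act (Cyclic._⊕_ n t s) X) (act-𝟎 : ∀ X → act (Cyclic.𝟎 n) X ≡ X)
  (base : List (List (Fin m))) where

  open Cyclic n
  open EdgeCount (_≟_ {m})

  baseEdges : List (Fin m × Fin m)
  baseEdges = edges base

  act-inverseˡ : ∀ t X → act (⊖ t) (act t X) ≡ X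
  act-inverseˡ t X = trans (act-∘ (⊖ t) t X) (trans (cong (λ u → act u X) (⊕-inverseʳ t)) (act-𝟎 X))

  act-inverseʳ : ∀ t X → act t (act (⊖ t) X) ≡ X
  act-inverseʳ t X = trans (act-∘ t (⊖ t) X) (trans (cong (λ u → act u X) (⊕-inverseˡ t)) (act-𝟎 X))

  actPerm : Z → Permutation′ m
  actPerm t = permutation (act t) (act (⊖ t)) (act-inverseʳ t) (act-inverseˡ t)

  translate : Z → List (List (Fin m))
  translate i = map (map (act i)) base

  factors : List (List (List (Fin m)))
  factors = map translate lowerHalf

  group : List (Permutation′ m)
  group = map actPerm allZ

  mult-translate : ∀ i X Y → mult _≟_ (translate i) X Y ≡ edgeCount baseEdges (act (⊖ i) X) (act (⊖ i) Y)
  mult-translate i X Y = begin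
    mult _≟_ (translate i) X Y                                ≡⟨ mult≡edgeCount (translate i) X Y ⟩
    edgeCount (edges (translate i)) X Y                       ≡⟨ cong (λ L → edgeCount L X Y) (edges-map (act i) base) ⟩
    edgeCount (map (both (act i)) baseEdges) X Y              ≡⟨ cong₂ (edgeCount (map (both (act i)) baseEdges))
                                                                   (sym (act-inverseʳ i X)) (sym (act-inverseʳ i Y)) ⟩
    edgeCount (map (both (act i)) baseEdges) (act i (act (⊖ i) X)) (act i (act (⊖ i) Y))
                                                              ≡⟨ EdgeCountMap.edgeCount-map-injective _≟_ _≟_ (act i) act-injective baseEdges _ _ ⟩
    edgeCount baseEdges (act (⊖ i) X) (act (⊖ i) Y)           ∎
    where
    open ≡-Reasoning
    act-injective : ∀ {X Y} → act i X ≡ act i Y → X ≡ Y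
    act-injective {X} {Y} eq = trans (sym (act-inverseˡ i X)) (trans (cong (act (⊖ i)) eq) (act-inverseˡ i Y))

  ∑-mult-factors : ∀ X Y →
    ∑ factors (λ F → mult _≟_ F X Y) ≡ ∑ lowerHalf (λ i → edgeCount baseEdges (act (⊖ i) X) (act (⊖ i) Y))
  ∑-mult-factors X Y = trans (∑-map lowerHalf translate _) (∑-cong lowerHalf (λ i _ → mult-translate i X Y))

  group-isPermGroup : IsPermGroup m group
  group-isPermGroup = (actPerm 𝟎 , ∈-map⁺ actPerm (∈-allFin 𝟎) , act-𝟎) , closed , inverses
    where
    closed : ∀ {g h} → g ∈ group → h ∈ group → ∃[ k ] (k ∈ group × (∀ x → k ⟨$⟩ʳ x ≡ g ⟨$⟩ʳ (h ⟨$⟩ʳ x)))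
    closed g∈ h∈ with s , _ , refl ← ∈-map⁻ actPerm g∈ | t , _ , refl ← ∈-map⁻ actPerm h∈ =
      actPerm (t ⊕ s) , ∈-map⁺ actPerm (∈-allFin _) , (λ x → sym (act-∘ s t x))
    inverses : ∀ {g} → g ∈ group → ∃[ k ] (k ∈ group × (∀ x → k ⟨$⟩ʳ (g ⟨$⟩ʳ x) ≡ x))
    inverses g∈ with s , _ , refl ← ∈-map⁻ actPerm g∈ = actPerm (⊖ s) , ∈-map⁺ actPerm (∈-allFin _) , act-inverseˡ s

  -- act s maps translate i onto translate (i ⊕ s), which is translate (i ⊕ s ⊕ ν) when i ⊕ s lies in the upper half.
  group-isAutGroup : (∀ X Y → edgeCount baseEdges (act ν X) (act ν Y) ≡ edgeCount baseEdges X Y) → IsAutGroup m factors group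
  group-isAutGroup invariant {g} {F} g∈ F∈ with s , _ , refl ← ∈-map⁻ actPerm g∈ | i , _ , refl ← ∈-map⁻ translate F∈
    with toℕ (i ⊕ s) <? n
  ... | yes lower = translate (i ⊕ s) , ∈-map⁺ translate (<⇒∈-lowerHalf lower) , λ x y →
        trans (mult-translate (i ⊕ s) (act s x) (act s y))
              (trans (cong₂ (edgeCount baseEdges) (untranslate x) (untranslate y)) (sym (mult-translate i x y)))
    where
    s-[i⊕s]≡⊖i : s - (i ⊕ s) ≡ ⊖ i
    s-[i⊕s]≡⊖i = trans (cong (_- (i ⊕ s)) (sym (⊕-identityˡ s))) (trans ([a⊕t]-[b⊕t]≡a-b 𝟎 i s) (⊕-identityˡ (⊖ i)))
    untranslate : ∀ x → act (⊖ (i ⊕ s)) (act s x) ≡ act (⊖ i) x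
    untranslate x = trans (act-∘ _ s x) (cong (λ u → act u x) s-[i⊕s]≡⊖i)
  ... | no upper = translate (i ⊕ s ⊕ ν) , ∈-map⁺ translate (<⇒∈-lowerHalf (upper⊕ν-lower (i ⊕ s) upper)) , λ x y →
        trans (mult-translate (i ⊕ s ⊕ ν) (act s x) (act s y))
              (trans (cong₂ (edgeCount baseEdges) (untranslate x) (untranslate y))
                     (trans (invariant _ _) (sym (mult-translate i x y))))
    where
    s-[i⊕s⊕ν]≡⊖i⊕ν : s - (i ⊕ s ⊕ ν) ≡ ⊖ i ⊕ ν
    s-[i⊕s⊕ν]≡⊖i⊕ν = trans (a-[t⊕ν]≡a-t⊕ν s (i ⊕ s))
      (cong (_⊕ ν) (trans (cong (_- (i ⊕ s)) (sym (⊕-identityˡ s))) (trans ([a⊕t]-[b⊕t]≡a-b 𝟎 i s) (⊕-identityˡ (⊖ i)))))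
    untranslate : ∀ x → act (⊖ (i ⊕ s ⊕ ν)) (act s x) ≡ act ν (act (⊖ i) x)
    untranslate x = trans (act-∘ _ s x) (trans (cong (λ u → act u x) s-[i⊕s⊕ν]≡⊖i⊕ν) (sym (act-∘ ν (⊖ i) x)))

  translate-isFactorOfType : (L : List ℕ) → IsFactorOfType m L base → ∀ i → IsFactorOfType m L (translate i)
  translate-isFactorOfType L ((base↭ , long) , lengths) i =
    ( ↭-trans (subst (_↭ map (act i) (allFin m)) (sym (List.concat-map base)) (Perm.map⁺ (act i) base↭))
              (map-inverse-allFin-↭ (act i) (act (⊖ i)) (act-inverseˡ i) (act-inverseʳ i))
    , All.map⁺ (All.map (λ {c} long-c → subst (2 ≤_) (sym (List.length-map (act i) c)) long-c) long) )
    , subst (_↭ L) (sym lengths≡) lengths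
    where
    lengths≡ : map length (translate i) ≡ map length base
    lengths≡ = trans (sym (List.map-∘ base)) (List.map-cong (List.length-map (act i)) base)

  module _ (ι : Z → Fin m) (ι-injective : ∀ {u v} → ι u ≡ ι v → u ≡ v) (act-ι : ∀ t z → act t (ι z) ≡ ι (z ⊕ t))
           (fixed : List (Fin m)) (unique-fixed : Unique fixed) (act-fixed : ∀ t {X} → X ∈ fixed → act t X ≡ X)
           (classify : ∀ X → X ∈ fixed ⊎ ∃[ z ] (X ≡ ι z)) where

    private
      ι-not-fixed : ∀ z → ¬ FixedBy group (ι z)
      ι-not-fixed z fixed-z = a⊕ν≢a z (ι-injective (trans (sym (act-ι ν z)) (All.lookup fixed-z (∈-map⁺ actPerm (∈-allFin ν)))))

      fixed⇒FixedBy : ∀ {X} → X ∈ fixed → FixedBy group X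
      fixed⇒FixedBy X∈ = All.map⁺ (All.universal (λ t → act-fixed t X∈) allZ)

      moved⇒ι : ∀ X → ¬ FixedBy group X → ∃[ z ] (X ≡ ι z)
      moved⇒ι X moved with classify X
      ... | inj₁ X∈    = ⊥-elim (moved (fixed⇒FixedBy X∈))
      ... | inj₂ X≡ιz = X≡ιz

    group-fixesExactly : FixesExactlyAndSharplyTransitive m (length fixed) group
    group-fixesExactly = (fixed , refl , unique-fixed , λ X → fixed⇒FixedBy , FixedBy⇒fixed X) , sharp
      where
      FixedBy⇒fixed : ∀ X → FixedBy group X → X ∈ fixed
      FixedBy⇒fixed X fixed-X with classify X
      ... | inj₁ X∈         = X∈
      ... | inj₂ (z , refl) = ⊥-elim (ι-not-fixed z fixed-X)
      sharp : ∀ X Y → ¬ FixedBy group X → ¬ FixedBy group Y →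
        (∃[ g ] (g ∈ group × g ⟨$⟩ʳ X ≡ Y)) ×
        (∀ {g g′} → g ∈ group → g′ ∈ group → g ⟨$⟩ʳ X ≡ Y → g′ ⟨$⟩ʳ X ≡ Y → ∀ z → g ⟨$⟩ʳ z ≡ g′ ⟨$⟩ʳ z)
      sharp X Y moved-X moved-Y with u , refl ← moved⇒ι X moved-X | v , refl ← moved⇒ι Y moved-Y =
        (actPerm (v - u) , ∈-map⁺ actPerm (∈-allFin _) , trans (act-ι _ u) (cong ι u⊕[v-u]≡v)) , unique
        where
        u⊕[v-u]≡v : u ⊕ (v - u) ≡ v
        u⊕[v-u]≡v = trans (⊕-comm u (v - u)) (sym (-≡⇒≡⊕ {v} {u} refl))
        unique : ∀ {g g′} → g ∈ group → g′ ∈ group → g ⟨$⟩ʳ ι u ≡ ι v → g′ ⟨$⟩ʳ ι u ≡ ι v → ∀ z → g ⟨$⟩ʳ z ≡ g′ ⟨$⟩ʳ z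
        unique g∈ g′∈ g-u≡v g′-u≡v z with s , _ , refl ← ∈-map⁻ actPerm g∈ | s′ , _ , refl ← ∈-map⁻ actPerm g′∈ =
          cong (λ t → act t z) (⊕-cancelˡ u s s′ (ι-injective (trans (sym (act-ι s u)) (trans g-u≡v (trans (sym g′-u≡v) (act-ι s′ u))))))

    pyramidal : (L : List ℕ) (target : Fin m → Fin m → ℕ) → IsFactorOfType m L base →
      (∀ X Y → edgeCount baseEdges (act ν X) (act ν Y) ≡ edgeCount baseEdges X Y) →
      (∀ X Y → ∑ lowerHalf (λ i → edgeCount baseEdges (act (⊖ i) X) (act (⊖ i) Y)) ≡ target X Y) →
      PyramidalFactorization m (length fixed) L target
    pyramidal L target base-type invariant covers =
      factors , (All.map⁺ (All.universal (translate-isFactorOfType L base-type) lowerHalf) , λ X Y → trans (∑-mult-factors X Y) (covers X Y))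
      , group , group-isPermGroup , group-isAutGroup invariant , group-fixesExactly

-- ℤ₂ₙ ∪ {∞₁ , ∞₂}, encoded as Fin (2n + 2) with ∞₁ and ∞₂ the last two points.
module TwoPoints (n : ℕ) .{{_ : NonZero n}} where
  open Cyclic n

  V : Set
  V = Fin (2 * n + 2)

  ι : Z → V
  ι z = z ↑ˡ 2

  ∞₁ ∞₂ : V
  ∞₁ = 2 * n ↑ʳ zero
  ∞₂ = 2 * n ↑ʳ suc zero

  ι-injective : ∀ {u v} → ι u ≡ ι v → u ≡ v
  ι-injective = ↑ˡ-injective 2 _ _

  private
    split : V → Sum._⊎_ Z (Fin 2)
    split = splitAt (2 * n)

  ι≢∞₁ : ∀ z → ι z ≢ ∞₁
  ι≢∞₁ z eq with () ← trans (sym (splitAt-↑ˡ (2 * n) z 2)) (trans (cong split eq) (splitAt-↑ʳ (2 * n) 2 zero))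

  ι≢∞₂ : ∀ z → ι z ≢ ∞₂
  ι≢∞₂ z eq with () ← trans (sym (splitAt-↑ˡ (2 * n) z 2)) (trans (cong split eq) (splitAt-↑ʳ (2 * n) 2 (suc zero)))

  ∞₁≢∞₂ : ∞₁ ≢ ∞₂
  ∞₁≢∞₂ eq with () ← trans (sym (splitAt-↑ʳ (2 * n) 2 zero)) (trans (cong split eq) (splitAt-↑ʳ (2 * n) 2 (suc zero)))

  data View : V → Set where
    ι-view  : (z : Z) → View (ι z)
    ∞₁-view : View ∞₁
    ∞₂-view : View ∞₂

  view : (X : V) → View X
  view X with split X in eq
  ... | inj₁ z          = subst View (splitAt⁻¹-↑ˡ eq) (ι-view z)
  ... | inj₂ zero       = subst View (splitAt⁻¹-↑ʳ eq) ∞₁-view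
  ... | inj₂ (suc zero) = subst View (splitAt⁻¹-↑ʳ eq) ∞₂-view

  act : Z → V → V
  act t X = join (2 * n) 2 (Sum.map₁ (_⊕ t) (split X))

  act-ι : ∀ t z → act t (ι z) ≡ ι (z ⊕ t)
  act-ι t z = cong (λ s → join (2 * n) 2 (Sum.map₁ (_⊕ t) s)) (splitAt-↑ˡ (2 * n) z 2)

  act-∞₁ : ∀ t → act t ∞₁ ≡ ∞₁
  act-∞₁ t = cong (λ s → join (2 * n) 2 (Sum.map₁ (_⊕ t) s)) (splitAt-↑ʳ (2 * n) 2 zero)

  act-∞₂ : ∀ t → act t ∞₂ ≡ ∞₂
  act-∞₂ t = cong (λ s → join (2 * n) 2 (Sum.map₁ (_⊕ t) s)) (splitAt-↑ʳ (2 * n) 2 (suc zero))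

  act-∘ : ∀ s t X → act s (act t X) ≡ act (t ⊕ s) X
  act-∘ s t X = go (view X)
    where
    go : ∀ {X} → View X → act s (act t X) ≡ act (t ⊕ s) X
    go (ι-view z) = trans (cong (act s) (act-ι t z)) (trans (act-ι s (z ⊕ t)) (trans (cong ι (⊕-assoc z t s)) (sym (act-ι (t ⊕ s) z))))
    go ∞₁-view    = trans (cong (act s) (act-∞₁ t)) (trans (act-∞₁ s) (sym (act-∞₁ (t ⊕ s))))
    go ∞₂-view    = trans (cong (act s) (act-∞₂ t)) (trans (act-∞₂ s) (sym (act-∞₂ (t ⊕ s))))

  act-𝟎 : ∀ X → act 𝟎 X ≡ X
  act-𝟎 X = go (view X)
    where
    go : ∀ {X} → View X → act 𝟎 X ≡ X
    go (ι-view z) = trans (act-ι 𝟎 z) (cong ι (⊕-identityʳ z))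
    go ∞₁-view    = act-∞₁ 𝟎
    go ∞₂-view    = act-∞₂ 𝟎

  private
    swap : Fin 2 → Fin 2
    swap zero       = suc zero
    swap (suc zero) = zero

  partner : V → V
  partner X = join (2 * n) 2 (Sum.map (_⊕ ν) swap (split X))

  partner-ι : ∀ z → partner (ι z) ≡ ι (z ⊕ ν)
  partner-ι z = cong (λ s → join (2 * n) 2 (Sum.map (_⊕ ν) swap s)) (splitAt-↑ˡ (2 * n) z 2)

  partner-∞₁ : partner ∞₁ ≡ ∞₂
  partner-∞₁ = cong (λ s → join (2 * n) 2 (Sum.map (_⊕ ν) swap s)) (splitAt-↑ʳ (2 * n) 2 zero)

  partner-∞₂ : partner ∞₂ ≡ ∞₁
  partner-∞₂ = cong (λ s → join (2 * n) 2 (Sum.map (_⊕ ν) swap s)) (splitAt-↑ʳ (2 * n) 2 (suc zero))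

  partner-isOneFactor : IsOneFactor (2 * n + 2) partner
  partner-isOneFactor = (λ X → involutive (view X)) , (λ X → no-fixed-point (view X))
    where
    involutive : ∀ {X} → View X → partner (partner X) ≡ X
    involutive (ι-view z) = trans (cong partner (partner-ι z)) (trans (partner-ι (z ⊕ ν)) (cong ι (a⊕ν⊕ν≡a z)))
    involutive ∞₁-view    = trans (cong partner partner-∞₁) partner-∞₂
    involutive ∞₂-view    = trans (cong partner partner-∞₂) partner-∞₁
    no-fixed-point : ∀ {X} → View X → partner X ≢ X
    no-fixed-point (ι-view z) eq = a⊕ν≢a z (ι-injective (trans (sym (partner-ι z)) eq))
    no-fixed-point ∞₁-view    eq = ∞₁≢∞₂ (sym (trans (sym partner-∞₁) eq))
    no-fixed-point ∞₂-view    eq = ∞₁≢∞₂ (trans (sym partner-∞₂) eq)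

  classify : ∀ X → X ∈ ∞₁ ∷ ∞₂ ∷ [] ⊎ ∃[ z ] (X ≡ ι z)
  classify X with view X
  ... | ι-view z = inj₂ (z , refl)
  ... | ∞₁-view  = inj₁ (here refl)
  ... | ∞₂-view  = inj₁ (there (here refl))

  act-∞ : ∀ t {X} → X ∈ ∞₁ ∷ ∞₂ ∷ [] → act t X ≡ X
  act-∞ t (here refl)         = act-∞₁ t
  act-∞ t (there (here refl)) = act-∞₂ t

  unique-∞ : Unique (∞₁ ∷ ∞₂ ∷ [])
  unique-∞ = (∞₁≢∞₂ ∷ []) ∷ [] ∷ []

  ∞∞ι↭allFin : ∞₁ ∷ ∞₂ ∷ map ι allZ ↭ allFin (2 * n + 2)
  ∞∞ι↭allFin = unique-⇔⇒↭ unique (Unique.allFin⁺ _) (λ X _ → ∈-allFin X) (λ X _ → covered X (view X))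
    where
    not-ι : ∀ {X} → (∀ z → ι z ≢ X) → X ∉ map ι allZ
    not-ι X∉ X∈ with z , _ , X≡ιz ← ∈-map⁻ ι X∈ = X∉ z (sym X≡ιz)
    unique : Unique (∞₁ ∷ ∞₂ ∷ map ι allZ)
    unique = (∞₁≢∞₂ ∷ All.tabulate (λ ∞₁∈ ∞₁≡ → not-ι ι≢∞₁ (subst (_∈ map ι allZ) (sym ∞₁≡) ∞₁∈)))
           ∷ All.tabulate (λ ∞₂∈ ∞₂≡ → not-ι ι≢∞₂ (subst (_∈ map ι allZ) (sym ∞₂≡) ∞₂∈))
           ∷ Unique.map⁺ ι-injective (Unique.allFin⁺ (2 * n))
    covered : ∀ X → View X → X ∈ ∞₁ ∷ ∞₂ ∷ map ι allZ
    covered _ (ι-view z) = there (there (∈-map⁺ ι (∈-allFin z)))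
    covered _ ∞₁-view    = here refl
    covered _ ∞₂-view    = there (here refl)

module _ {m : ℕ} (p : Fin m → Fin m) {x y : Fin m} where

  multKplus-≡ : x ≡ y → multKplus m p x y ≡ 0
  multKplus-≡ x≡y with x ≟ y
  ... | yes _   = refl
  ... | no x≢y = ⊥-elim (x≢y x≡y)

  multKplus-partner : x ≢ y → p x ≡ y → multKplus m p x y ≡ 2
  multKplus-partner x≢y px≡y with x ≟ y | p x ≟ y
  ... | yes x≡y | _          = ⊥-elim (x≢y x≡y)
  ... | no _    | yes _      = refl
  ... | no _    | no px≢y    = ⊥-elim (px≢y px≡y)

  multKplus-other : x ≢ y → p x ≢ y → multKplus m p x y ≡ 1
  multKplus-other x≢y px≢y with x ≟ y | p x ≟ y
  ... | yes x≡y | _         = ⊥-elim (x≢y x≡y)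
  ... | no _    | yes px≡y  = ⊥-elim (px≢y px≡y)
  ... | no _    | no _      = refl

  multKminus-≡ : x ≡ y → multKminus m p x y ≡ 0
  multKminus-≡ x≡y with x ≟ y
  ... | yes _   = refl
  ... | no x≢y = ⊥-elim (x≢y x≡y)

  multKminus-partner : p x ≡ y → multKminus m p x y ≡ 0
  multKminus-partner px≡y with x ≟ y | p x ≟ y
  ... | yes _ | _          = refl
  ... | no _  | yes _      = refl
  ... | no _  | no px≢y    = ⊥-elim (px≢y px≡y)

  multKminus-other : x ≢ y → p x ≢ y → multKminus m p x y ≡ 1
  multKminus-other x≢y px≢y with x ≟ y | p x ≟ y
  ... | yes x≡y | _         = ⊥-elim (x≢y x≡y)
  ... | no _    | yes px≡y  = ⊥-elim (px≢y px≡y)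
  ... | no _    | no _      = refl

-- Closing the path a ⋯ b of Σ by the edge {b , a} of difference n, and developing over the lower half of ℤ₂ₙ.
module OPplusFromStarter (n : ℕ) .{{_ : NonZero n}} {ℓ∞ : ℕ} {ℓs : List ℕ} (st : Starter n ℓ∞ ℓs) where
  open Cyclic n
  open StarterStructure n st
  open EdgeCount (_≟_ {2 * n})

  base : List (List Z)
  base = (a ∷ path) ∷ cycles

  open Development n (λ t z → z ⊕ t) (λ s t z → ⊕-assoc z t s) ⊕-identityʳ base

  baseEdges↭ : baseEdges ↭ (b , a) ∷ finiteEdges
  baseEdges↭ = begin
    cycleEdges (a ∷ path) ++ edges cycles                  ≡⟨ cong (_++ edges cycles) (cycleEdges-∷ a path) ⟩
    (pathEdges a path ++ [ (b , a) ]) ++ edges cycles      ≡⟨ List.++-assoc (pathEdges a path) [ (b , a) ] (edges cycles) ⟩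
    pathEdges a path ++ (b , a) ∷ edges cycles             ↭⟨ Perm.shift (b , a) (pathEdges a path) (edges cycles) ⟩
    (b , a) ∷ finiteEdges                                  ∎
    where open PermutationReasoning

  a≡b⊕ν : a ≡ b ⊕ ν
  a≡b⊕ν = sym (trans (cong (_⊕ ν) b≡a⊕ν) (a⊕ν⊕ν≡a a))

  baseEdges-invariant : ∀ u v → edgeCount baseEdges (u ⊕ ν) (v ⊕ ν) ≡ edgeCount baseEdges u v
  baseEdges-invariant u v = begin
    edgeCount baseEdges (u ⊕ ν) (v ⊕ ν)                                                      ≡⟨ edgeCount-↭ _ _ baseEdges↭ ⟩
    ind (joins? (u ⊕ ν) (v ⊕ ν) (b , a)) + edgeCount finiteEdges (u ⊕ ν) (v ⊕ ν)             ≡⟨ cong₂ _+_ (antipodal-edge-invariant u v b a a≡b⊕ν)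
                                                                                                          (finiteEdges-invariant u v) ⟩
    ind (joins? u v (b , a)) + edgeCount finiteEdges u v                                     ≡⟨ edgeCount-↭ _ _ baseEdges↭ ⟨
    edgeCount baseEdges u v                                                                  ∎
    where open ≡-Reasoning

  baseEdges-irrefl : ∀ {u v} → (u , v) ∈ baseEdges → u ≢ v
  baseEdges-irrefl e∈ with Perm.∈-resp-↭ baseEdges↭ e∈
  ... | here refl  = λ b≡a → a⊕ν≢a a (trans (sym b≡a⊕ν) b≡a)
  ... | there e∈′ = finiteEdges-irrefl e∈′

  -- Besides the ±d edges of Σ, the closing edge contributes the difference ±n.
  base-diffCount-± : ∀ d → d ≢ 𝟎 → diffCount baseEdges d + diffCount baseEdges (⊖ d) ≡ suc (ind (ν ≟ d)) + suc (ind (ν ≟ d))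
  base-diffCount-± d d≢𝟎 = begin
    diffCount baseEdges d + diffCount baseEdges (⊖ d)                    ≡⟨ cong₂ _+_ (split d) (trans (split (⊖ d)) ν-term) ⟩
    (i + diffCount finiteEdges d) + (i + diffCount finiteEdges (⊖ d))    ≡⟨ interchange i _ i _ ⟩
    (i + i) + (diffCount finiteEdges d + diffCount finiteEdges (⊖ d))    ≡⟨ cong (i + i +_) (finite-diffCount-± d d≢𝟎) ⟩
    (i + i) + 2                                                           ≡⟨ trans (+-comm (i + i) 2) (cong suc (sym (+-suc i i))) ⟩
    suc i + suc i                                                         ∎
    where
    open ≡-Reasoning
    i : ℕ
    i = ind (ν ≟ d)
    b-a≡ν : b - a ≡ ν
    b-a≡ν = ≡⊕⇒-≡ (trans b≡a⊕ν (⊕-comm a ν))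
    split : ∀ e → diffCount baseEdges e ≡ ind (ν ≟ e) + diffCount finiteEdges e
    split e = trans (∑-↭ _ baseEdges↭) (cong (_+ diffCount finiteEdges e) (ind-cong (b - a ≟ e) (ν ≟ e) (trans (sym b-a≡ν)) (trans b-a≡ν)))
    ν-term : ind (ν ≟ ⊖ d) + diffCount finiteEdges (⊖ d) ≡ i + diffCount finiteEdges (⊖ d)
    ν-term = cong (_+ diffCount finiteEdges (⊖ d)) (ind-ν≟⊖ d)

  covers : ∀ X Y → ∑ lowerHalf (λ i → edgeCount baseEdges (X - i) (Y - i)) ≡ multKplus (2 * n) (_⊕ ν) X Y
  covers X Y = by-cases (X ≟ Y)
    where
    by-cases : Dec (X ≡ Y) → ∑ lowerHalf (λ i → edgeCount baseEdges (X - i) (Y - i)) ≡ multKplus (2 * n) (_⊕ ν) X Y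
    by-cases (yes refl) = trans (∑-zero lowerHalf _ (λ i _ → edgeCount-irrefl baseEdges baseEdges-irrefl (X - i)))
                                (sym (multKplus-≡ (_⊕ ν) refl))
    by-cases (no X≢Y)  = trans (∑-lowerHalf-translates baseEdges baseEdges-invariant X Y X≢Y _ (base-diffCount-± (X - Y) X-Y≢𝟎))
                               (target (ν ≟ X - Y))
      where
      X-Y≢𝟎 : X - Y ≢ 𝟎
      X-Y≢𝟎 eq = X≢Y (x-y≡𝟎⇒x≡y X Y eq)
      target : (q : Dec (ν ≡ X - Y)) → suc (ind q) ≡ multKplus (2 * n) (_⊕ ν) X Y
      target (yes ν≡X-Y) = sym (multKplus-partner (_⊕ ν) X≢Y (ν≡-⇒⊕ν≡ ν≡X-Y))
      target (no ν≢X-Y)  = sym (multKplus-other (_⊕ ν) X≢Y (λ X⊕ν≡Y → ν≢X-Y (⊕ν≡⇒ν≡- X⊕ν≡Y)))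

  base-type : IsFactorOfType (2 * n) (ℓ∞ ∸ 1 ∷ ℓs) base
  base-type = (vertices , two≤length path≢[] ∷ All.map (≤-trans (n≤1+n 2)) cycles-long)
            , subst (λ k → map length base ↭ k ∷ ℓs) (cong (_∸ 1) length-path) (prep _ cycles-lengths)
    where
    two≤length : ∀ {w} → w ≢ [] → 2 ≤ length (a ∷ w)
    two≤length {[]}    w≢[] = ⊥-elim (w≢[] refl)
    two≤length {_ ∷ _} _    = s≤s (s≤s z≤n)

  opPlus : OPplusPyramidal (2 * n) 0 (ℓ∞ ∸ 1 ∷ ℓs)
  opPlus = (_⊕ ν) , (a⊕ν⊕ν≡a , a⊕ν≢a)
         , pyramidal (λ z → z) (λ eq → eq) (λ _ _ → refl) [] [] (λ _ ()) (λ X → inj₂ (X , refl))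
                     (ℓ∞ ∸ 1 ∷ ℓs) (multKplus (2 * n) (_⊕ ν)) base-type baseEdges-invariant covers

module OPminusFromStarter (n : ℕ) .{{_ : NonZero n}} {ℓ∞ : ℕ} {ℓs : List ℕ} (st : Starter n ℓ∞ ℓs) where
  open Cyclic n
  open StarterStructure n st
  open TwoPoints n
  module ZCount = EdgeCount (_≟_ {2 * n})
  open EdgeCount (_≟_ {2 * n + 2})

  -- ∞ of Σ becomes ∞₁, and ∞₂ is inserted between the antipodal neighbours x and x ⊕ ν of the path a ⋯ b.
  module Construction (R Q : List Z) (x : Z) (path≡ : path ≡ R ++ x ⊕ ν ∷ Q) (end≡ : pathEnd a R ≡ x) where

    y : Z
    y = x ⊕ ν

    cycle∞ : List V
    cycle∞ = ∞₁ ∷ ι a ∷ (map ι R ++ ∞₂ ∷ ι y ∷ map ι Q)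

    base : List (List V)
    base = cycle∞ ∷ map (map ι) cycles

    open Development n act act-∘ act-𝟎 base

    innerEdges : List (Z × Z)
    innerEdges = pathEdges a R ++ pathEdges y Q ++ edges cycles

    ∞Edges : List (V × V)
    ∞Edges = (∞₁ , ι a) ∷ (ι x , ∞₂) ∷ (∞₂ , ι y) ∷ (ι b , ∞₁) ∷ []

    private
      pathEdges≡ : pathEdges a path ≡ pathEdges a R ++ (x , y) ∷ pathEdges y Q
      pathEdges≡ = trans (cong (pathEdges a) path≡)
        (trans (pathEdges-++ a R (y ∷ Q)) (cong (λ e → pathEdges a R ++ (e , y) ∷ pathEdges y Q) end≡))

      b≡ : b ≡ pathEnd y Q
      b≡ = trans (cong (pathEnd a) path≡) (trans (pathEnd-++ a R (y ∷ Q)) (cong (λ e → pathEnd e (y ∷ Q)) end≡))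

    finiteEdges↭ : finiteEdges ↭ (x , y) ∷ innerEdges
    finiteEdges↭ = begin
      pathEdges a path ++ edges cycles                           ≡⟨ cong (_++ edges cycles) pathEdges≡ ⟩
      (pathEdges a R ++ (x , y) ∷ pathEdges y Q) ++ edges cycles ≡⟨ List.++-assoc (pathEdges a R) _ (edges cycles) ⟩
      pathEdges a R ++ (x , y) ∷ pathEdges y Q ++ edges cycles   ↭⟨ Perm.shift (x , y) (pathEdges a R) _ ⟩
      (x , y) ∷ innerEdges                                       ∎
      where open PermutationReasoning

    baseEdges↭ : baseEdges ↭ ∞Edges ++ map (both ι) innerEdges
    baseEdges↭ = begin
      cycleEdges cycle∞ ++ edges (map (map ι) cycles)
        ≡⟨ cong₂ _++_ cycleEdges-cycle∞ (edges-map ι cycles) ⟩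
      (∞₁ , ι a) ∷ ((XR ++ (ι x , ∞₂) ∷ (∞₂ , ι y) ∷ XQ) ++ [ (ι b , ∞₁) ]) ++ XC
        ≡⟨ cong ((∞₁ , ι a) ∷_) (trans (List.++-assoc (XR ++ _) [ (ι b , ∞₁) ] XC) (List.++-assoc XR _ ((ι b , ∞₁) ∷ XC))) ⟩
      (∞₁ , ι a) ∷ XR ++ (ι x , ∞₂) ∷ (∞₂ , ι y) ∷ XQ ++ (ι b , ∞₁) ∷ XC
        ↭⟨ prep _ (Perm.shifts XR ((ι x , ∞₂) ∷ (∞₂ , ι y) ∷ [])) ⟩
      (∞₁ , ι a) ∷ (ι x , ∞₂) ∷ (∞₂ , ι y) ∷ XR ++ XQ ++ (ι b , ∞₁) ∷ XC
        ≡⟨ cong (λ l → (∞₁ , ι a) ∷ (ι x , ∞₂) ∷ (∞₂ , ι y) ∷ l) (List.++-assoc XR XQ _) ⟨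
      (∞₁ , ι a) ∷ (ι x , ∞₂) ∷ (∞₂ , ι y) ∷ (XR ++ XQ) ++ (ι b , ∞₁) ∷ XC
        ↭⟨ prep _ (prep _ (prep _ (Perm.shift (ι b , ∞₁) (XR ++ XQ) XC))) ⟩
      ∞Edges ++ (XR ++ XQ) ++ XC
        ≡⟨ cong (∞Edges ++_) (trans (List.++-assoc XR XQ XC) (sym (map-inner))) ⟩
      ∞Edges ++ map (both ι) innerEdges ∎
      where
      open PermutationReasoning
      XR XQ XC : List (V × V)
      XR = map (both ι) (pathEdges a R)
      XQ = map (both ι) (pathEdges y Q)
      XC = map (both ι) (edges cycles)
      map-inner : map (both ι) innerEdges ≡ XR ++ XQ ++ XC
      map-inner = trans (List.map-++ (both ι) (pathEdges a R) _) (cong (XR ++_) (List.map-++ (both ι) (pathEdges y Q) _))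
      cycleEdges-cycle∞ : cycleEdges cycle∞ ≡ (∞₁ , ι a) ∷ (XR ++ (ι x , ∞₂) ∷ (∞₂ , ι y) ∷ XQ) ++ [ (ι b , ∞₁) ]
      cycleEdges-cycle∞ = trans (cycleEdges-∷ ∞₁ (ι a ∷ map ι R ++ ∞₂ ∷ ι y ∷ map ι Q))
        (cong₂ (λ P e → (∞₁ , ι a) ∷ P ++ [ (e , ∞₁) ]) path-part end-part)
        where
        ιx≡ : pathEnd (ι a) (map ι R) ≡ ι x
        ιx≡ = trans (pathEnd-map ι a R) (cong ι end≡)
        path-part : pathEdges (ι a) (map ι R ++ ∞₂ ∷ ι y ∷ map ι Q) ≡ XR ++ (ι x , ∞₂) ∷ (∞₂ , ι y) ∷ XQ
        path-part = trans (pathEdges-++ (ι a) (map ι R) (∞₂ ∷ ι y ∷ map ι Q))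
          (trans (cong₂ (λ P e → P ++ (e , ∞₂) ∷ (∞₂ , ι y) ∷ pathEdges (ι y) (map ι Q)) (pathEdges-map ι a R) ιx≡)
                 (cong (λ P → XR ++ (ι x , ∞₂) ∷ (∞₂ , ι y) ∷ P) (pathEdges-map ι y Q)))
        end-part : pathEnd (ι a) (map ι R ++ ∞₂ ∷ ι y ∷ map ι Q) ≡ ι b
        end-part = trans (pathEnd-++ (ι a) (map ι R) (∞₂ ∷ ι y ∷ map ι Q)) (trans (pathEnd-map ι y Q) (cong ι (sym b≡)))

    -- Spoke W c: W is a point at infinity whose neighbours in cycle∞ are c and c ⊕ ν.
    data Spoke : V → Z → Set where
      spoke₁ : Spoke ∞₁ a
      spoke₂ : Spoke ∞₂ x

    data Kind : V → Set where
      finite   : (z : Z) → Kind (ι z)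
      infinite : ∀ {W} c → Spoke W c → Kind W

    kind : (X : V) → Kind X
    kind X with view X
    ... | ι-view z = finite z
    ... | ∞₁-view  = infinite a spoke₁
    ... | ∞₂-view  = infinite x spoke₂

    private
      AtInfinity : V → Set
      AtInfinity W = ∀ z → ι z ≢ W

      spoke-at-∞ : ∀ {W c} → Spoke W c → AtInfinity W
      spoke-at-∞ spoke₁ = ι≢∞₁
      spoke-at-∞ spoke₂ = ι≢∞₂

      partner-at-∞ : ∀ {W c} → Spoke W c → AtInfinity (partner W)
      partner-at-∞ spoke₁ z eq = ι≢∞₂ z (trans eq partner-∞₁)
      partner-at-∞ spoke₂ z eq = ι≢∞₁ z (trans eq partner-∞₂)

      act-spoke : ∀ {W c} t → Spoke W c → act t W ≡ W
      act-spoke t spoke₁ = act-∞₁ t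
      act-spoke t spoke₂ = act-∞₂ t

      ∞Edges-spokes : ∀ e → e ∈ ∞Edges →
        (AtInfinity (proj₁ e) × (∃[ z ] proj₂ e ≡ ι z)) ⊎ ((∃[ z ] proj₁ e ≡ ι z) × AtInfinity (proj₂ e))
      ∞Edges-spokes _ (here refl)                         = inj₁ (ι≢∞₁ , a , refl)
      ∞Edges-spokes _ (there (here refl))                 = inj₂ ((x , refl) , ι≢∞₂)
      ∞Edges-spokes _ (there (there (here refl)))         = inj₁ (ι≢∞₂ , y , refl)
      ∞Edges-spokes _ (there (there (there (here refl)))) = inj₂ ((b , refl) , ι≢∞₁)

      inward : ∀ u c {W} → AtInfinity W → ind (joins? (ι u) W (W , ι c)) ≡ ind (u ≟ c)
      inward u c {W} W∞ = ind-cong (joins? (ι u) W (W , ι c)) (u ≟ c)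
        (λ { (inj₁ (W≡ιu , _)) → ⊥-elim (W∞ u (sym W≡ιu)) ; (inj₂ (_ , ιc≡ιu)) → sym (ι-injective ιc≡ιu) })
        (λ { refl → inj₂ (refl , refl) })

      outward : ∀ u c {W} → AtInfinity W → ind (joins? (ι u) W (ι c , W)) ≡ ind (u ≟ c)
      outward u c {W} W∞ = ind-cong (joins? (ι u) W (ι c , W)) (u ≟ c)
        (λ { (inj₁ (ιc≡ιu , _)) → sym (ι-injective ιc≡ιu) ; (inj₂ (ιc≡W , _)) → ⊥-elim (W∞ c ιc≡W) })
        (λ { refl → inj₁ (refl , refl) })

      inward-miss : ∀ u c {W W′} → AtInfinity W′ → W′ ≢ W → ind (joins? (ι u) W (W′ , ι c)) ≡ 0
      inward-miss u c {W} {W′} W′∞ W′≢W = ind-no (joins? (ι u) W (W′ , ι c))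
        (λ { (inj₁ (W′≡ιu , _)) → W′∞ u (sym W′≡ιu) ; (inj₂ (W′≡W , _)) → W′≢W W′≡W })

      outward-miss : ∀ u c {W W′} → AtInfinity W → W′ ≢ W → ind (joins? (ι u) W (ι c , W′)) ≡ 0
      outward-miss u c {W} {W′} W∞ W′≢W = ind-no (joins? (ι u) W (ι c , W′))
        (λ { (inj₁ (_ , W′≡W)) → W′≢W W′≡W ; (inj₂ (ιc≡W , _)) → W∞ c ιc≡W })

    count : ∀ X Y → edgeCount baseEdges X Y ≡ edgeCount ∞Edges X Y + edgeCount (map (both ι) innerEdges) X Y
    count X Y = trans (edgeCount-↭ X Y baseEdges↭) (∑-++ ∞Edges (map (both ι) innerEdges) (λ e → ind (joins? X Y e)))

    count-ιι : ∀ u v → edgeCount baseEdges (ι u) (ι v) ≡ ZCount.edgeCount innerEdges u v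
    count-ιι u v = trans (count (ι u) (ι v))
      (cong₂ _+_ (edgeCount-zero ∞Edges (ι u) (ι v) no-spoke) (EdgeCountMap.edgeCount-map-injective _≟_ _≟_ ι ι-injective innerEdges u v))
      where
      no-spoke : ∀ e → e ∈ ∞Edges → ¬ Joins (ι u) (ι v) e
      no-spoke e e∈ joins with ∞Edges-spokes e e∈ | joins
      ... | inj₁ (e₁∞ , _) | inj₁ (e₁≡ , _) = e₁∞ u (sym e₁≡)
      ... | inj₁ (e₁∞ , _) | inj₂ (e₁≡ , _) = e₁∞ v (sym e₁≡)
      ... | inj₂ (_ , e₂∞) | inj₁ (_ , e₂≡) = e₂∞ v (sym e₂≡)
      ... | inj₂ (_ , e₂∞) | inj₂ (_ , e₂≡) = e₂∞ u (sym e₂≡)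

    count-∞∞ : ∀ {W W′ c c′} → Spoke W c → Spoke W′ c′ → edgeCount baseEdges W W′ ≡ 0
    count-∞∞ {W} {W′} s s′ = trans (count W W′)
      (cong₂ _+_ (edgeCount-zero ∞Edges W W′ no-edge) (EdgeCountMap.edgeCount-map-outside _≟_ _≟_ ι innerEdges W W′ (spoke-at-∞ s)))
      where
      no-edge : ∀ e → e ∈ ∞Edges → ¬ Joins W W′ e
      no-edge e e∈ joins with ∞Edges-spokes e e∈ | joins
      ... | inj₁ (_ , z , e₂≡)   | inj₁ (_ , e₂≡W′) = spoke-at-∞ s′ z (trans (sym e₂≡) e₂≡W′)
      ... | inj₁ (_ , z , e₂≡)   | inj₂ (_ , e₂≡W)  = spoke-at-∞ s z (trans (sym e₂≡) e₂≡W)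
      ... | inj₂ ((z , e₁≡) , _) | inj₁ (e₁≡W , _)  = spoke-at-∞ s z (trans (sym e₁≡) e₁≡W)
      ... | inj₂ ((z , e₁≡) , _) | inj₂ (e₁≡W′ , _) = spoke-at-∞ s′ z (trans (sym e₁≡) e₁≡W′)

    count-ι∞ : ∀ u {W c} → Spoke W c → edgeCount baseEdges (ι u) W ≡ ind (u ≟ c) + ind (u ≟ c ⊕ ν)
    count-ι∞ u {W} {c} s = trans (count (ι u) W) (trans (cong₂ _+_ (spokes s) inner-zero) (+-identityʳ _))
      where
      inner-zero : edgeCount (map (both ι) innerEdges) (ι u) W ≡ 0
      inner-zero = trans (edgeCount-sym (map (both ι) innerEdges) (ι u) W) (EdgeCountMap.edgeCount-map-outside _≟_ _≟_ ι innerEdges W (ι u) (spoke-at-∞ s))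
      spokes : ∀ {W c} → Spoke W c → edgeCount ∞Edges (ι u) W ≡ ind (u ≟ c) + ind (u ≟ c ⊕ ν)
      spokes spoke₁ = cong₂ _+_ (inward u a ι≢∞₁)
        (cong₂ _+_ (outward-miss u x ι≢∞₁ (∞₁≢∞₂ ∘ sym)) (cong₂ _+_ (inward-miss u y ι≢∞₂ (∞₁≢∞₂ ∘ sym))
          (trans (+-identityʳ _) (trans (outward u b ι≢∞₁) (ind-cong (u ≟ b) (u ≟ a ⊕ ν) (λ u≡b → trans u≡b b≡a⊕ν) (λ u≡ → trans u≡ (sym b≡a⊕ν)))))))
      spokes spoke₂ = trans (cong₂ _+_ (inward-miss u a ι≢∞₁ ∞₁≢∞₂)
        (cong₂ _+_ (outward u x ι≢∞₂) (cong₂ _+_ (inward u y ι≢∞₂) (trans (+-identityʳ _) (outward-miss u b ι≢∞₂ ∞₁≢∞₂)))))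
        (cong (ind (u ≟ x) +_) (+-identityʳ _))

    innerEdges-invariant : ∀ u v → ZCount.edgeCount innerEdges (u ⊕ ν) (v ⊕ ν) ≡ ZCount.edgeCount innerEdges u v
    innerEdges-invariant u v = +-cancelˡ-≡ (ind (ZCount.joins? u v (x , y))) _ _ (begin
      ind (ZCount.joins? u v (x , y)) + ZCount.edgeCount innerEdges (u ⊕ ν) (v ⊕ ν)
        ≡⟨ cong (_+ ZCount.edgeCount innerEdges (u ⊕ ν) (v ⊕ ν)) (antipodal-edge-invariant u v x y refl) ⟨
      ZCount.edgeCount ((x , y) ∷ innerEdges) (u ⊕ ν) (v ⊕ ν)   ≡⟨ ZCount.edgeCount-↭ _ _ finiteEdges↭ ⟨
      ZCount.edgeCount finiteEdges (u ⊕ ν) (v ⊕ ν)              ≡⟨ finiteEdges-invariant u v ⟩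
      ZCount.edgeCount finiteEdges u v                          ≡⟨ ZCount.edgeCount-↭ _ _ finiteEdges↭ ⟩
      ZCount.edgeCount ((x , y) ∷ innerEdges) u v               ∎)
      where open ≡-Reasoning

    innerEdges-irrefl : ∀ {u v} → (u , v) ∈ innerEdges → u ≢ v
    innerEdges-irrefl e∈ = finiteEdges-irrefl (Perm.∈-resp-↭ (↭-sym finiteEdges↭) (there e∈))

    -- The removed edge {x , x ⊕ ν} has difference ±n.
    inner-diffCount-± : ∀ d → d ≢ 𝟎 →
      ind (ν ≟ d) + ind (ν ≟ d) + (diffCount innerEdges d + diffCount innerEdges (⊖ d)) ≡ 2
    inner-diffCount-± d d≢𝟎 = begin
      i + i + (diffCount innerEdges d + diffCount innerEdges (⊖ d))     ≡⟨ interchange i i _ _ ⟩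
      (i + diffCount innerEdges d) + (i + diffCount innerEdges (⊖ d))   ≡⟨ cong₂ _+_ (split d) (trans (split (⊖ d)) (cong (_+ diffCount innerEdges (⊖ d)) (ind-ν≟⊖ d))) ⟨
      diffCount finiteEdges d + diffCount finiteEdges (⊖ d)             ≡⟨ finite-diffCount-± d d≢𝟎 ⟩
      2                                                                 ∎
      where
      open ≡-Reasoning
      i : ℕ
      i = ind (ν ≟ d)
      x-y≡ν : x - y ≡ ν
      x-y≡ν = ≡⊕⇒-≡ (trans (sym (a⊕ν⊕ν≡a x)) (⊕-comm y ν))
      split : ∀ e → diffCount finiteEdges e ≡ ind (ν ≟ e) + diffCount innerEdges e
      split e = trans (∑-↭ _ finiteEdges↭) (cong (_+ diffCount innerEdges e) (ind-cong (x - y ≟ e) (ν ≟ e) (trans (sym x-y≡ν)) (trans x-y≡ν)))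

    covers-finite : ∀ u v → Dec (u ≡ v) →
      ∑ lowerHalf (λ i → ZCount.edgeCount innerEdges (u - i) (v - i)) ≡ multKminus (2 * n + 2) partner (ι u) (ι v)
    covers-finite u v (yes refl) = trans (∑-zero lowerHalf _ (λ i _ → ZCount.edgeCount-irrefl innerEdges innerEdges-irrefl (u - i)))
                                         (sym (multKminus-≡ partner refl))
    covers-finite u v (no u≢v)   = by-ν (ν ≟ u - v) (inner-diffCount-± (u - v) (λ u-v≡𝟎 → u≢v (x-y≡𝟎⇒x≡y u v u-v≡𝟎)))
      where
      by-ν : (q : Dec (ν ≡ u - v)) → ind q + ind q + (diffCount innerEdges (u - v) + diffCount innerEdges (⊖ (u - v))) ≡ 2 →
        ∑ lowerHalf (λ i → ZCount.edgeCount innerEdges (u - i) (v - i)) ≡ multKminus (2 * n + 2) partner (ι u) (ι v)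
      by-ν (yes ν≡u-v) counts = trans (∑-lowerHalf-translates innerEdges innerEdges-invariant u v u≢v 0 (+-cancelˡ-≡ 2 _ 0 counts))
        (sym (multKminus-partner partner (trans (partner-ι u) (cong ι (ν≡-⇒⊕ν≡ ν≡u-v)))))
      by-ν (no ν≢u-v)  counts = trans (∑-lowerHalf-translates innerEdges innerEdges-invariant u v u≢v 1 counts)
        (sym (multKminus-other partner (u≢v ∘ ι-injective) (λ pu≡v → ν≢u-v (⊕ν≡⇒ν≡- (ι-injective (trans (sym (partner-ι u)) pu≡v))))))

    private
      pair-⊕ν : ∀ u c → ind (u ⊕ ν ≟ c) + ind (u ⊕ ν ≟ c ⊕ ν) ≡ ind (u ≟ c) + ind (u ≟ c ⊕ ν)
      pair-⊕ν u c = trans (cong₂ _+_ first second) (+-comm (ind (u ≟ c ⊕ ν)) (ind (u ≟ c)))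
        where
        first : ind (u ⊕ ν ≟ c) ≡ ind (u ≟ c ⊕ ν)
        first = ind-cong (u ⊕ ν ≟ c) (u ≟ c ⊕ ν) (λ eq → trans (sym (a⊕ν⊕ν≡a u)) (cong (_⊕ ν) eq)) (λ eq → trans (cong (_⊕ ν) eq) (a⊕ν⊕ν≡a c))
        second : ind (u ⊕ ν ≟ c ⊕ ν) ≡ ind (u ≟ c)
        second = ind-cong (u ⊕ ν ≟ c ⊕ ν) (u ≟ c) (⊕-cancelʳ ν u c) (cong (_⊕ ν))

    baseEdges-invariant : ∀ X Y → edgeCount baseEdges (act ν X) (act ν Y) ≡ edgeCount baseEdges X Y
    baseEdges-invariant X Y = go (kind X) (kind Y)
      where
      go : ∀ {X Y} → Kind X → Kind Y → edgeCount baseEdges (act ν X) (act ν Y) ≡ edgeCount baseEdges X Y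
      go (finite u)     (finite v)       = trans (cong₂ (edgeCount baseEdges) (act-ι ν u) (act-ι ν v))
                                                 (trans (count-ιι _ _) (trans (innerEdges-invariant u v) (sym (count-ιι u v))))
      go (finite u)     (infinite c s)   = trans (cong₂ (edgeCount baseEdges) (act-ι ν u) (act-spoke ν s))
                                                 (trans (count-ι∞ _ s) (trans (pair-⊕ν u c) (sym (count-ι∞ u s))))
      go (infinite c s) (finite v)       = trans (edgeCount-sym baseEdges _ _) (trans (go (finite v) (infinite c s)) (edgeCount-sym baseEdges _ _))
      go (infinite c s) (infinite c′ s′) = cong₂ (edgeCount baseEdges) (act-spoke ν s) (act-spoke ν s′)

    covers : ∀ X Y → ∑ lowerHalf (λ i → edgeCount baseEdges (act (⊖ i) X) (act (⊖ i) Y)) ≡ multKminus (2 * n + 2) partner X Y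
    covers X Y = go (kind X) (kind Y)
      where
      go : ∀ {X Y} → Kind X → Kind Y → ∑ lowerHalf (λ i → edgeCount baseEdges (act (⊖ i) X) (act (⊖ i) Y)) ≡ multKminus (2 * n + 2) partner X Y
      go (finite u)     (finite v)       = trans (∑-cong lowerHalf (λ i _ → trans (cong₂ (edgeCount baseEdges) (act-ι (⊖ i) u) (act-ι (⊖ i) v)) (count-ιι _ _)))
                                                 (covers-finite u v (u ≟ v))
      go (finite u)     (infinite c s)   = trans (∑-cong lowerHalf (λ i _ → trans (cong₂ (edgeCount baseEdges) (act-ι (⊖ i) u) (act-spoke (⊖ i) s)) (count-ι∞ _ s)))
                                                 (trans (∑-lowerHalf-hits-pair u c)
                                                   (sym (multKminus-other partner (spoke-at-∞ s u) (λ pu≡W → spoke-at-∞ s (u ⊕ ν) (trans (sym (partner-ι u)) pu≡W)))))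
      go (infinite c s) (finite v)       = trans (∑-cong lowerHalf (λ i _ → trans (cong₂ (edgeCount baseEdges) (act-spoke (⊖ i) s) (act-ι (⊖ i) v))
                                                                                  (trans (edgeCount-sym baseEdges _ _) (count-ι∞ _ s))))
                                                 (trans (∑-lowerHalf-hits-pair v c)
                                                   (sym (multKminus-other partner (λ W≡ιv → spoke-at-∞ s v (sym W≡ιv)) (λ pW≡ιv → partner-at-∞ s v (sym pW≡ιv)))))
      go (infinite c s) (infinite c′ s′) = trans (∑-zero lowerHalf _ (λ i _ → trans (cong₂ (edgeCount baseEdges) (act-spoke (⊖ i) s) (act-spoke (⊖ i) s′)) (count-∞∞ s s′)))
                                                 (sym (at-infinity s s′))
        where
        at-infinity : ∀ {W W′ c c′} → Spoke W c → Spoke W′ c′ → multKminus (2 * n + 2) partner W W′ ≡ 0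
        at-infinity spoke₁ spoke₁ = multKminus-≡ partner refl
        at-infinity spoke₁ spoke₂ = multKminus-partner partner partner-∞₁
        at-infinity spoke₂ spoke₁ = multKminus-partner partner partner-∞₂
        at-infinity spoke₂ spoke₂ = multKminus-≡ partner refl

    base-type : IsFactorOfType (2 * n + 2) (suc ℓ∞ ∷ ℓs) base
    base-type = (vertices↭ , s≤s (s≤s z≤n) ∷ All.map⁺ (All.map (λ {c} long → subst (2 ≤_) (sym (List.length-map ι c)) (≤-trans (n≤1+n 2) long)) cycles-long))
              , subst (λ k → map length base ↭ k ∷ ℓs) length-cycle∞ (prep _ (subst (_↭ ℓs) (sym lengths≡) cycles-lengths))
      where
      cycle∞↭ : cycle∞ ↭ ∞₁ ∷ ∞₂ ∷ map ι (a ∷ path)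
      cycle∞↭ = prep ∞₁ (↭-trans (Perm.shift ∞₂ (ι a ∷ map ι R) (ι y ∷ map ι Q))
                  (prep ∞₂ (↭-reflexive (cong (ι a ∷_) (sym (trans (cong (map ι) path≡) (List.map-++ ι R (y ∷ Q))))))))
      vertices↭ : concat base ↭ allFin (2 * n + 2)
      vertices↭ = begin
        cycle∞ ++ concat (map (map ι) cycles)               ≡⟨ cong (cycle∞ ++_) (List.concat-map cycles) ⟩
        cycle∞ ++ map ι (concat cycles)                     ↭⟨ Perm.++⁺ʳ _ cycle∞↭ ⟩
        ∞₁ ∷ ∞₂ ∷ map ι (a ∷ path) ++ map ι (concat cycles) ≡⟨ cong (λ l → ∞₁ ∷ ∞₂ ∷ l) (List.map-++ ι (a ∷ path) (concat cycles)) ⟨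
        ∞₁ ∷ ∞₂ ∷ map ι ((a ∷ path) ++ concat cycles)       ↭⟨ prep ∞₁ (prep ∞₂ (Perm.map⁺ ι vertices)) ⟩
        ∞₁ ∷ ∞₂ ∷ map ι allZ                                ↭⟨ ∞∞ι↭allFin ⟩
        allFin (2 * n + 2)                                  ∎
        where open PermutationReasoning
      length-cycle∞ : length cycle∞ ≡ suc ℓ∞
      length-cycle∞ = trans (Perm.↭-length cycle∞↭) (cong suc (trans (cong (λ k → suc (suc k)) (List.length-map ι path)) length-path))
      lengths≡ : map length (map (map ι) cycles) ≡ map length cycles
      lengths≡ = trans (sym (List.map-∘ cycles)) (List.map-cong (List.length-map ι) cycles)

    opMinus : OPminusPyramidal (2 * n + 2) 2 (suc ℓ∞ ∷ ℓs)
    opMinus = partner , partner-isOneFactor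
            , pyramidal ι ι-injective act-ι (∞₁ ∷ ∞₂ ∷ []) unique-∞ act-∞ classify
                        (suc ℓ∞ ∷ ℓs) (multKminus (2 * n + 2) partner) base-type baseEdges-invariant covers

  opMinus : OPminusPyramidal (2 * n + 2) 2 (suc ℓ∞ ∷ ℓs)
  opMinus = split antipodal-step
    where
    split : ∃[ R ] ∃[ Q ] ∃[ x ] (path ≡ R ++ x ⊕ ν ∷ Q × pathEnd a R ≡ x) → OPminusPyramidal (2 * n + 2) 2 (suc ℓ∞ ∷ ℓs)
    split (R , Q , x , path≡ , end≡) = Construction.opMinus R Q x path≡ end≡

theorem2p11 : (n : ℕ) .{{_ : NonZero n}} (ℓ∞ : ℕ) (ℓs : List ℕ) →
    Starter n ℓ∞ ℓs →
    OPminusPyramidal (2 * n + 2) 2 (suc ℓ∞ ∷ ℓs) × OPplusPyramidal (2 * n) 0 (ℓ∞ ∸ 1 ∷ ℓs)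
theorem2p11 n ℓ∞ ℓs st = OPminusFromStarter.opMinus n st , OPplusFromStarter.opPlus n st
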